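{- Let $n, \alpha, \beta$ be integers with $n \ge 4$, $n$ even, and $1 \le \alpha, \beta < n/2$. Let $G = G^{(7)}(n;\alpha,\beta)$ be the graph with vertex set $\{a_j, b_j, c_j, d_j, e_j, f_j, g_j : j \in \mathbb{Z}_n\}$ and edges, for every $j \in \mathbb{Z}_n$: $a_j a_{j+\alpha}$, $a_j b_j$, $b_j b_{j+n/2}$, $b_j c_j$, $c_j d_j$, $c_j e_j$, $d_j d_{j+n/2}$, $e_j e_{j+n/2}$, $d_j f_j$, $e_j f_j$, $f_j g_j$, $g_j g_{j+\beta}$. Then $G$ is a nut graph if and only if, among all complex $n$-th roots of unity, the polynomial $$3x^{2\alpha + \beta + \frac{n}{2}} + 3x^{\beta + \frac{n}{2}} + 2x^{2\alpha + 2\beta} + 2x^{2\alpha} - 2x^{\alpha + \beta} + 2x^{2\beta} + 2 \in \mathbb{Z}[x]$$ has $-1$ as a root and has no other root.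
   Context: A nut graph is a simple graph with at least two vertices whose adjacency matrix has a one-dimensional null space spanned by a vector with no zero entries. The graph $G$ described is the derived graph of a $\mathbb{Z}_n$-voltage pregraph on seven vertices $a,\dots,g$ (a cubic $7$-circulant graph). -}

module Defs where

open import Level using (Level)
open import Data.Nat as ℕ using (ℕ; zero; suc; _%_)
open import Data.Nat.DivMod using (m%n<n)
open import Data.Fin as Fin using (Fin; toℕ; fromℕ<)
open import Data.Fin.Properties using () renaming (_≟_ to _≟F_)
open import Data.Bool using (Bool; true; false; _∨_)
open import Data.Rational as ℚ using (ℚ; 0ℚ; 1ℚ)
open import Data.Product using (Σ; ∃; _×_; _,_)
open import Relation.Nullary using (¬_)
open import Relation.Nullary.Decidable using (⌊_⌋)
open import Relation.Binary.PropositionalEquality using (_≡_; _≢_)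
open import Algebra.Bundles using (CommutativeRing)

addMod : ∀ {n} → Fin n → ℕ → Fin n
addMod {suc m} j k = fromℕ< (m%n<n (toℕ j ℕ.+ k) (suc m))

_==_ : ∀ {n} → Fin n → Fin n → Bool
i == j = ⌊ i ≟F j ⌋

data Label : Set where
  a b c d e f g : Label

Vertex : ℕ → Set
Vertex n = Label × Fin n

-- Here h stands for n/2.
listedEdge : ∀ {n} (h α β : ℕ) → Vertex n → Vertex n → Bool
listedEdge h α β (a , i) (a , j) = j == addMod i α
listedEdge h α β (a , i) (b , j) = i == j
listedEdge h α β (b , i) (b , j) = j == addMod i h
listedEdge h α β (b , i) (c , j) = i == j
listedEdge h α β (c , i) (d , j) = i == j
listedEdge h α β (c , i) (e , j) = i == j
listedEdge h α β (d , i) (d , j) = j == addMod i h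
listedEdge h α β (e , i) (e , j) = j == addMod i h
listedEdge h α β (d , i) (f , j) = i == j
listedEdge h α β (e , i) (f , j) = i == j
listedEdge h α β (f , i) (g , j) = i == j
listedEdge h α β (g , i) (g , j) = j == addMod i β
listedEdge h α β _ _ = false

adjG7 : (n α β : ℕ) → Vertex n → Vertex n → Bool
adjG7 n α β u v =
  listedEdge (n ℕ./ 2) α β u v ∨ listedEdge (n ℕ./ 2) α β v u

boolℚ : Bool → ℚ
boolℚ true = 1ℚ
boolℚ false = 0ℚ

adjMatrixG7 : (n α β : ℕ) → Vertex n → Vertex n → ℚ
adjMatrixG7 n α β u v = boolℚ (adjG7 n α β u v)

sumFin : ∀ n → (Fin n → ℚ) → ℚ
sumFin zero    x = 0ℚ
sumFin (suc n) x = x Fin.zero ℚ.+ sumFin n (λ i → x (Fin.suc i))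

sumLabel : (Label → ℚ) → ℚ
sumLabel x = x a ℚ.+ (x b ℚ.+ (x c ℚ.+ (x d ℚ.+ (x e ℚ.+ (x f ℚ.+ x g)))))

sumVertex : ∀ n → (Vertex n → ℚ) → ℚ
sumVertex n x = sumLabel (λ l → sumFin n (λ j → x (l , j)))

InKernel : ∀ {n} → (Vertex n → Vertex n → ℚ) → (Vertex n → ℚ) → Set
InKernel {n} A x = ∀ u → sumVertex n (λ v → A u v ℚ.* x v) ≡ 0ℚ

IsNutGraph : ∀ {n} → (Vertex n → Vertex n → ℚ) → Set
IsNutGraph {n} A =
  (∃ λ (u : Vertex n) → ∃ λ (v : Vertex n) → u ≢ v) ×
  (∃ λ (x : Vertex n → ℚ) →
      InKernel A x ×
      (∀ v → x v ≢ 0ℚ) ×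
      (∀ y → InKernel A y → ∃ λ (t : ℚ) → ∀ v → y v ≡ t ℚ.* x v))

module _ {c ℓ : Level} (K : CommutativeRing c ℓ) where
  open CommutativeRing K

  pow : Carrier → ℕ → Carrier
  pow x zero    = 1#
  pow x (suc k) = x * pow x k

  natK : ℕ → Carrier
  natK zero    = 0#
  natK (suc m) = 1# + natK m

  IsField : Set (c Level.⊔ ℓ)
  IsField = ¬ (1# ≈ 0#) × (∀ x → ¬ (x ≈ 0#) → ∃ λ y → x * y ≈ 1#)

  CharZero : Set ℓ
  CharZero = ∀ m → ¬ (natK (suc m) ≈ 0#)

  IsPrimitiveRoot : ℕ → Carrier → Set ℓ
  IsPrimitiveRoot n ω = pow ω n ≈ 1# × (∀ k → 1 ℕ.≤ k → k ℕ.< n → ¬ (pow ω k ≈ 1#))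

  polyG7 : (h α β : ℕ) → Carrier → Carrier
  polyG7 h α β x =
    natK 3 * pow x (2 ℕ.* α ℕ.+ β ℕ.+ h)
    + natK 3 * pow x (β ℕ.+ h)
    + natK 2 * pow x (2 ℕ.* α ℕ.+ 2 ℕ.* β)
    + natK 2 * pow x (2 ℕ.* α)
    - natK 2 * pow x (α ℕ.+ β)
    + natK 2 * pow x (2 ℕ.* β)
    + natK 2

{-# OPTIONS --safe #-}
module Submission where

-- Every kernel vector x of G is determined by D = x_d: the rows at b, …, g force the other
-- coordinates, and the rows at a become L D = 0 for an operator L on ℚ^ℤₙ that commutes with
-- the shift. Its symbol at an n-th root of unity z is z^-(α+β) times the polynomial.
--
-- If -1 is the only root among the n-th roots of unity in K, Fourier inversion with the
-- primitive root ω shows that ker L is spanned by ((-1)^j), which extends to a kernel vector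
-- without zero entries. Conversely, if G is a nut graph, ker L = ℚ·D₀ is shift invariant, so
-- D₀ is a shift eigenvector with a rational eigenvalue μ, μⁿ = 1, and μ = -1 since the symbol
-- does not vanish at 1. As ker L is one-dimensional, a linear relation among ((-1)^j),
-- δ₀ + δ₋₁ and L e₀, …, L eₙ₋₂ puts δ₀ + δ₋₁ into the image of L. The Fourier functional at a
-- root z of the polynomial kills that image and sends δ₀ + δ₋₁ to 1 + z, so z = -1.

open import Level using (Level)
open import Algebra.Bundles using (CommutativeRing)
open import Data.Nat as ℕ using (ℕ; zero; suc; _≤_; _<_; _/_)
open import Data.Nat.Divisibility using (_∣_)
import Data.Nat.Properties as ℕP
open import Data.Integer as ℤ using (ℤ)
import Data.Integer.Properties as ℤP
open import Data.Fin as Fin using (Fin; toℕ)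
import Data.Fin.Properties as FinP
open import Data.Rational as ℚ using (ℚ; 0ℚ; 1ℚ)
import Data.Rational.Properties as ℚP
open import Data.Product using (Σ; ∃; _×_; _,_; proj₁; proj₂)
open import Data.Sum using (_⊎_; inj₁; inj₂)
open import Data.Empty using (⊥-elim)
open import Data.Bool using (Bool; true; false)
open import Relation.Nullary using (¬_; yes; no; Dec)
open import Relation.Binary.PropositionalEquality as ≡ using (_≡_; _≢_)
open import Function.Bundles using (_⇔_; mk⇔)
open import Defs hiding (a; b; c; d; e; f; g)

module RingArithmetic {c ℓ : Level} (R : CommutativeRing c ℓ) where
  open CommutativeRing R hiding (zero)
  open import Algebra.Properties.Ring ring public
    using (-1*x≈-x; -‿distribˡ-*; -‿distribʳ-*; -‿involutive; -0#≈0#; -‿+-comm; x∙y⁻¹≈ε⇒x≈y; +-inverseˡ-unique; +-inverseʳ-unique)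
  open import Algebra.Properties.Semiring.Mult semiring using (×-homo-+; ×1-homo-*)
    renaming (_×_ to _·_)
  open import Algebra.Properties.CommutativeSemiring.Exp commutativeSemiring
    using (_^_; ^-congˡ; ^-homo-*; ^-assocʳ; ^-distrib-*)
  open import Algebra.Properties.CommutativeMonoid.Sum +-commutativeMonoid public
    using (sum; sum-cong-≋; sum-replicate; sum-replicate-zero; sum-permute; sum-remove; ∑-comm; ∑-distrib-+)
  open import Algebra.Properties.Semiring.Sum semiring public using (*-distribˡ-sum; *-distribʳ-sum)
  open import Relation.Binary.Reasoning.Setoid setoid
  open import Function using (_∘_)
  open import Data.Sign.Base as Sign using (Sign)
  open import Data.Maybe.Base using (Maybe; just; nothing)
  open import Algebra.Solver.Ring.AlmostCommutativeRing using (fromCommutativeRing; _-Raw-AlmostCommutative⟶_)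
  import Algebra.Solver.Ring

  ≡⇒≈ : ∀ {x y} → x ≡ y → x ≈ y
  ≡⇒≈ ≡.refl = refl

  natK≡· : ∀ m → natK R m ≡ m · 1#
  natK≡· zero    = ≡.refl
  natK≡· (suc m) = ≡.cong (1# +_) (natK≡· m)

  natK-+ : ∀ m n → natK R (m ℕ.+ n) ≈ natK R m + natK R n
  natK-+ m n = begin
    natK R (m ℕ.+ n)      ≡⟨ natK≡· (m ℕ.+ n) ⟩
    (m ℕ.+ n) · 1#        ≈⟨ ×-homo-+ 1# m n ⟩
    m · 1# + n · 1#       ≡⟨ ≡.cong₂ _+_ (natK≡· m) (natK≡· n) ⟨
    natK R m + natK R n   ∎

  natK-* : ∀ m n → natK R (m ℕ.* n) ≈ natK R m * natK R n
  natK-* m n = begin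
    natK R (m ℕ.* n)      ≡⟨ natK≡· (m ℕ.* n) ⟩
    (m ℕ.* n) · 1#        ≈⟨ ×1-homo-* m n ⟩
    m · 1# * n · 1#       ≡⟨ ≡.cong₂ _*_ (natK≡· m) (natK≡· n) ⟨
    natK R m * natK R n   ∎

  pow≡^ : ∀ x k → pow R x k ≡ x ^ k
  pow≡^ x zero    = ≡.refl
  pow≡^ x (suc k) = ≡.cong (x *_) (pow≡^ x k)

  pow-cong : ∀ {x y} k → x ≈ y → pow R x k ≈ pow R y k
  pow-cong {x} {y} k x≈y = begin
    pow R x k  ≡⟨ pow≡^ x k ⟩
    x ^ k      ≈⟨ ^-congˡ k x≈y ⟩
    y ^ k      ≡⟨ pow≡^ y k ⟨
    pow R y k  ∎

  pow-+ : ∀ x m n → pow R x (m ℕ.+ n) ≈ pow R x m * pow R x n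
  pow-+ x m n = begin
    pow R x (m ℕ.+ n)        ≡⟨ pow≡^ x (m ℕ.+ n) ⟩
    x ^ (m ℕ.+ n)            ≈⟨ ^-homo-* x m n ⟩
    x ^ m * x ^ n            ≡⟨ ≡.cong₂ _*_ (pow≡^ x m) (pow≡^ x n) ⟨
    pow R x m * pow R x n    ∎

  pow-* : ∀ x m n → pow R x (m ℕ.* n) ≈ pow R (pow R x m) n
  pow-* x m n = begin
    pow R x (m ℕ.* n)        ≡⟨ pow≡^ x (m ℕ.* n) ⟩
    x ^ (m ℕ.* n)            ≈⟨ ^-assocʳ x m n ⟨
    (x ^ m) ^ n              ≡⟨ ≡.trans (pow≡^ (pow R x m) n) (≡.cong (_^ n) (pow≡^ x m)) ⟨
    pow R (pow R x m) n      ∎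

  pow-distrib-* : ∀ x y k → pow R (x * y) k ≈ pow R x k * pow R y k
  pow-distrib-* x y k = begin
    pow R (x * y) k          ≡⟨ pow≡^ (x * y) k ⟩
    (x * y) ^ k              ≈⟨ ^-distrib-* x y k ⟩
    x ^ k * y ^ k            ≡⟨ ≡.cong₂ _*_ (pow≡^ x k) (pow≡^ y k) ⟨
    pow R x k * pow R y k    ∎

  1-pow : ∀ k → pow R 1# k ≈ 1#
  1-pow zero    = refl
  1-pow (suc k) = trans (*-identityˡ _) (1-pow k)

  pow-pow-root : ∀ {x} N k → pow R x N ≈ 1# → pow R (pow R x k) N ≈ 1#
  pow-pow-root {x} N k xᴺ≈1 = begin
    pow R (pow R x k) N   ≈⟨ pow-* x k N ⟨
    pow R x (k ℕ.* N)     ≡⟨ ≡.cong (pow R x) (ℕP.*-comm k N) ⟩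
    pow R x (N ℕ.* k)     ≈⟨ pow-* x N k ⟩
    pow R (pow R x N) k   ≈⟨ pow-cong k xᴺ≈1 ⟩
    pow R 1# k            ≈⟨ 1-pow k ⟩
    1#                    ∎

  pow-mod : ∀ {x} N .{{_ : ℕ.NonZero N}} → pow R x N ≈ 1# → ∀ k → pow R x (k ℕ.% N) ≈ pow R x k
  pow-mod {x} N xᴺ≈1 k = begin
    pow R x (k % N)                                ≈⟨ *-identityʳ _ ⟨
    pow R x (k % N) * 1#                           ≈⟨ *-congˡ (trans (pow-cong (k / N) xᴺ≈1) (1-pow (k / N))) ⟨
    pow R x (k % N) * pow R (pow R x N) (k / N)    ≈⟨ *-congˡ (pow-* x N (k / N)) ⟨
    pow R x (k % N) * pow R x (N ℕ.* (k / N))      ≈⟨ pow-+ x (k % N) (N ℕ.* (k / N)) ⟨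
    pow R x (k % N ℕ.+ N ℕ.* (k / N))              ≡⟨ ≡.cong (pow R x) (≡.trans (≡.cong (k % N ℕ.+_) (ℕP.*-comm N (k / N))) (≡.sym (m≡m%n+[m/n]*n k N))) ⟩
    pow R x k                                      ∎
    where open import Data.Nat.DivMod using (_%_; _/_; m≡m%n+[m/n]*n)

  sum-zero : ∀ {N} (f : Fin N → Carrier) → (∀ i → f i ≈ 0#) → sum f ≈ 0#
  sum-zero {N} f f≈0 = trans (sum-cong-≋ f≈0) (sum-replicate-zero N)

  sum-ones : ∀ N → sum {N} (λ _ → 1#) ≈ natK R N
  sum-ones N = trans (sum-replicate N) (≡⇒≈ (≡.sym (natK≡· N)))

  sum-neg : ∀ {N} (f : Fin N → Carrier) → sum (λ i → - f i) ≈ - sum f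
  sum-neg {zero}  f = sym -0#≈0#
  sum-neg {suc N} f = trans (+-congˡ (sum-neg (λ i → f (Fin.suc i)))) (-‿+-comm _ _)

  sum-δ : ∀ {N} (f : Fin N → Carrier) (t : Fin N) → (∀ j → j ≢ t → f j ≈ 0#) → sum f ≈ f t
  sum-δ {suc N} f Fin.zero    f≈0 =
    trans (+-congˡ (sum-zero _ (λ i → f≈0 (Fin.suc i) λ ()))) (+-identityʳ _)
  sum-δ {suc N} f (Fin.suc t) f≈0 =
    trans (+-cong (f≈0 Fin.zero λ ()) (sum-δ (f ∘ Fin.suc) t λ j j≢t → f≈0 (Fin.suc j) (j≢t ∘ FinP.suc-injective)))
          (+-identityˡ _)

  sum-δ₂ : ∀ {N} (f : Fin N → Carrier) {t₁ t₂ : Fin N} → t₁ ≢ t₂ →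
           (∀ j → j ≢ t₁ → j ≢ t₂ → f j ≈ 0#) → sum f ≈ f t₁ + f t₂
  sum-δ₂ {suc N} f {Fin.zero}   {Fin.zero}   t₁≢t₂ f≈0 = ⊥-elim (t₁≢t₂ ≡.refl)
  sum-δ₂ {suc N} f {Fin.zero}   {Fin.suc t₂} t₁≢t₂ f≈0 =
    +-congˡ (sum-δ (f ∘ Fin.suc) t₂ λ j j≢t₂ → f≈0 (Fin.suc j) (λ ()) (j≢t₂ ∘ FinP.suc-injective))
  sum-δ₂ {suc N} f {Fin.suc t₁} {Fin.zero}   t₁≢t₂ f≈0 =
    trans (+-congˡ (sum-δ (f ∘ Fin.suc) t₁ λ j j≢t₁ → f≈0 (Fin.suc j) (j≢t₁ ∘ FinP.suc-injective) (λ ())))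
          (+-comm _ _)
  sum-δ₂ {suc N} f {Fin.suc t₁} {Fin.suc t₂} t₁≢t₂ f≈0 =
    trans (+-cong (f≈0 Fin.zero (λ ()) (λ ()))
                  (sum-δ₂ (f ∘ Fin.suc) (t₁≢t₂ ∘ ≡.cong Fin.suc)
                          λ j j≢t₁ j≢t₂ → f≈0 (Fin.suc j) (j≢t₁ ∘ FinP.suc-injective) (j≢t₂ ∘ FinP.suc-injective)))
          (+-identityˡ _)

  open import Algebra.Properties.CommutativeSemigroup +-commutativeSemigroup using (interchange)
  open import Algebra.Properties.CommutativeSemigroup *-commutativeSemigroup public
    using () renaming (interchange to *-interchange)

  -- The clause for 1 makes the solver constant con (ℤ.+ 1) definitionally 1#,
  -- and con (ℤ.+ k) is definitionally natK R k for every other k ≥ 0.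
  fromℤ : ℤ → Carrier
  fromℤ (ℤ.+ 1)    = 1#
  fromℤ (ℤ.+ m)    = natK R m
  fromℤ ℤ.-[1+ m ] = - natK R (suc m)

  fromℤ-+ : ∀ m → fromℤ (ℤ.+ m) ≈ natK R m
  fromℤ-+ zero          = refl
  fromℤ-+ (suc zero)    = sym (+-identityʳ 1#)
  fromℤ-+ (suc (suc m)) = refl

  fromℤ-⊖ : ∀ m n → fromℤ (m ℤ.⊖ n) ≈ natK R m - natK R n
  fromℤ-⊖ m zero = begin
    fromℤ (m ℤ.⊖ 0)    ≡⟨ ≡.cong fromℤ (ℤP.⊖-≥ {m} {0} ℕ.z≤n) ⟩
    fromℤ (ℤ.+ m)      ≈⟨ fromℤ-+ m ⟩
    natK R m           ≈⟨ +-identityʳ _ ⟨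
    natK R m + 0#      ≈⟨ +-congˡ -0#≈0# ⟨
    natK R m - 0#      ∎
  fromℤ-⊖ zero (suc n) = sym (+-identityˡ _)
  fromℤ-⊖ (suc m) (suc n) = begin
    fromℤ (suc m ℤ.⊖ suc n)                   ≡⟨ ≡.cong fromℤ (ℤP.[1+m]⊖[1+n]≡m⊖n m n) ⟩
    fromℤ (m ℤ.⊖ n)                           ≈⟨ fromℤ-⊖ m n ⟩
    natK R m - natK R n                       ≈⟨ +-identityˡ _ ⟨
    0# + (natK R m - natK R n)                ≈⟨ +-congʳ (-‿inverseʳ 1#) ⟨
    (1# - 1#) + (natK R m - natK R n)         ≈⟨ interchange 1# (natK R m) (- 1#) (- natK R n) ⟨
    natK R (suc m) + (- 1# - natK R n)        ≈⟨ +-congˡ (-‿+-comm 1# (natK R n)) ⟩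
    natK R (suc m) - natK R (suc n)           ∎

  fromℤ-homo-+ : ∀ i j → fromℤ (i ℤ.+ j) ≈ fromℤ i + fromℤ j
  fromℤ-homo-+ (ℤ.+ m) (ℤ.+ n) =
    trans (fromℤ-+ (m ℕ.+ n)) (trans (natK-+ m n) (sym (+-cong (fromℤ-+ m) (fromℤ-+ n))))
  fromℤ-homo-+ (ℤ.+ m) ℤ.-[1+ n ] = trans (fromℤ-⊖ m (suc n)) (+-congʳ (sym (fromℤ-+ m)))
  fromℤ-homo-+ ℤ.-[1+ m ] (ℤ.+ n) =
    trans (fromℤ-⊖ n (suc m)) (trans (+-comm _ _) (+-congˡ (sym (fromℤ-+ n))))
  fromℤ-homo-+ ℤ.-[1+ m ] ℤ.-[1+ n ] = begin
    - natK R (suc (suc (m ℕ.+ n)))         ≡⟨ ≡.cong (λ k → - natK R (suc k)) (ℕP.+-suc m n) ⟨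
    - natK R (suc m ℕ.+ suc n)             ≈⟨ -‿cong (natK-+ (suc m) (suc n)) ⟩
    - (natK R (suc m) + natK R (suc n))    ≈⟨ -‿+-comm _ _ ⟨
    - natK R (suc m) - natK R (suc n)      ∎

  fromℤ-homo-neg : ∀ i → fromℤ (ℤ.- i) ≈ - fromℤ i
  fromℤ-homo-neg (ℤ.+ zero)    = sym -0#≈0#
  fromℤ-homo-neg (ℤ.+ suc m)   = -‿cong (sym (fromℤ-+ (suc m)))
  fromℤ-homo-neg ℤ.-[1+ m ]    = trans (fromℤ-+ (suc m)) (sym (-‿involutive _))

  fromSign : Sign → Carrier
  fromSign Sign.+ = 1#
  fromSign Sign.- = - 1#

  fromSign-* : ∀ s t → fromSign (s Sign.* t) ≈ fromSign s * fromSign t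
  fromSign-* Sign.+ t      = sym (*-identityˡ _)
  fromSign-* Sign.- Sign.+ = sym (*-identityʳ _)
  fromSign-* Sign.- Sign.- = trans (sym (-‿involutive 1#)) (trans (-‿cong (sym (-1*x≈-x 1#))) (-‿distribʳ-* _ _))

  fromℤ-◃ : ∀ s m → fromℤ (s ℤ.◃ m) ≈ fromSign s * natK R m
  fromℤ-◃ s      zero    = sym (zeroʳ _)
  fromℤ-◃ Sign.+ (suc m) = trans (fromℤ-+ (suc m)) (sym (*-identityˡ _))
  fromℤ-◃ Sign.- (suc m) = sym (-1*x≈-x _)

  fromℤ≈sign*abs : ∀ i → fromℤ i ≈ fromSign (ℤ.sign i) * natK R ℤ.∣ i ∣
  fromℤ≈sign*abs i = trans (≡⇒≈ (≡.cong fromℤ (≡.sym (ℤP.◃-inverse i)))) (fromℤ-◃ (ℤ.sign i) ℤ.∣ i ∣)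

  fromℤ-homo-* : ∀ i j → fromℤ (i ℤ.* j) ≈ fromℤ i * fromℤ j
  fromℤ-homo-* i j = begin
    fromℤ (i ℤ.* j)
      ≈⟨ fromℤ-◃ (ℤ.sign i Sign.* ℤ.sign j) (ℤ.∣ i ∣ ℕ.* ℤ.∣ j ∣) ⟩
    fromSign (ℤ.sign i Sign.* ℤ.sign j) * natK R (ℤ.∣ i ∣ ℕ.* ℤ.∣ j ∣)
      ≈⟨ *-cong (fromSign-* (ℤ.sign i) (ℤ.sign j)) (natK-* ℤ.∣ i ∣ ℤ.∣ j ∣) ⟩
    (fromSign (ℤ.sign i) * fromSign (ℤ.sign j)) * (natK R ℤ.∣ i ∣ * natK R ℤ.∣ j ∣)
      ≈⟨ *-interchange _ _ _ _ ⟩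
    (fromSign (ℤ.sign i) * natK R ℤ.∣ i ∣) * (fromSign (ℤ.sign j) * natK R ℤ.∣ j ∣)
      ≈⟨ *-cong (fromℤ≈sign*abs i) (fromℤ≈sign*abs j) ⟨
    fromℤ i * fromℤ j
      ∎

  fromℤ-morphism : ℤ.+-*-rawRing -Raw-AlmostCommutative⟶ fromCommutativeRing R
  fromℤ-morphism = record
    { ⟦_⟧ = fromℤ ; +-homo = fromℤ-homo-+ ; *-homo = fromℤ-homo-* ; -‿homo = fromℤ-homo-neg
    ; 0-homo = refl ; 1-homo = refl }

  fromℤ-≟ : ∀ i j → Maybe (fromℤ i ≈ fromℤ j)
  fromℤ-≟ i j with i ℤ.≟ j
  ... | yes ≡.refl = just refl
  ... | no _       = nothing

  module Solver = Algebra.Solver.Ring ℤ.+-*-rawRing (fromCommutativeRing R) fromℤ-morphism fromℤ-≟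

  geometric-sum : ∀ r N → sum {N} (λ k → pow R r (toℕ k)) * (r - 1#) ≈ pow R r N - 1#
  geometric-sum r zero    = trans (zeroˡ _) (sym (-‿inverseʳ 1#))
  geometric-sum r (suc N) = begin
    (1# + sum {N} (λ k → pow R r (toℕ (Fin.suc k)))) * (r - 1#)  ≈⟨ *-congʳ (+-congˡ (*-distribˡ-sum {N} r (λ k → pow R r (toℕ k)))) ⟨
    (1# + r * S) * (r - 1#)                                   ≈⟨ solve 2 (λ r S → (con (ℤ.+ 1) :+ r :* S) :* (r :- con (ℤ.+ 1))
                                                                          := (r :- con (ℤ.+ 1)) :+ r :* (S :* (r :- con (ℤ.+ 1)))) refl r S ⟩
    (r - 1#) + r * (S * (r - 1#))                             ≈⟨ +-congˡ (*-congˡ (geometric-sum r N)) ⟩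
    (r - 1#) + r * (pow R r N - 1#)                           ≈⟨ solve 2 (λ r P → (r :- con (ℤ.+ 1)) :+ r :* (P :- con (ℤ.+ 1))
                                                                          := r :* P :- con (ℤ.+ 1)) refl r (pow R r N) ⟩
    r * pow R r N - 1#                                        ∎
    where
    open Solver
    S : Carrier
    S = sum {N} (λ k → pow R r (toℕ k))

  polyG7-cong : ∀ h α β {x y} → x ≈ y → polyG7 R h α β x ≈ polyG7 R h α β y
  polyG7-cong h α β {x} {y} x≈y =
    +-congʳ (+-cong (+-cong (+-cong (+-cong (+-cong (term (2 ℕ.* α ℕ.+ β ℕ.+ h)) (term (β ℕ.+ h)))
                                            (term (2 ℕ.* α ℕ.+ 2 ℕ.* β)))
                                    (term (2 ℕ.* α)))
                            (-‿cong (term (α ℕ.+ β))))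
                    (term (2 ℕ.* β)))
    where
    term : ∀ {c} k → c * pow R x k ≈ c * pow R y k
    term k = *-congˡ (pow-cong k x≈y)

ℚ-ring : CommutativeRing _ _
ℚ-ring = ℚP.+-*-commutativeRing

module FieldLemmas {c ℓ : Level} (K : CommutativeRing c ℓ) (isField : IsField K) where
  open CommutativeRing K hiding (zero)
  open RingArithmetic K using (sum; geometric-sum; x∙y⁻¹≈ε⇒x≈y)
  open import Relation.Binary.Reasoning.Setoid setoid

  1≉0 : ¬ (1# ≈ 0#)
  1≉0 = proj₁ isField

  inverse : ∀ x → ¬ (x ≈ 0#) → Carrier
  inverse x x≉0 = proj₁ (proj₂ isField x x≉0)

  *-inverseʳ : ∀ x x≉0 → x * inverse x x≉0 ≈ 1#
  *-inverseʳ x x≉0 = proj₂ (proj₂ isField x x≉0)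

  *-inverseˡ : ∀ x x≉0 → inverse x x≉0 * x ≈ 1#
  *-inverseˡ x x≉0 = trans (*-comm _ _) (*-inverseʳ x x≉0)

  *-cancelˡ : ∀ {a x y} → ¬ (a ≈ 0#) → a * x ≈ a * y → x ≈ y
  *-cancelˡ {a} {x} {y} a≉0 ax≈ay = begin
    x                       ≈⟨ *-identityˡ x ⟨
    1# * x                  ≈⟨ *-congʳ (*-inverseˡ a a≉0) ⟨
    (inverse a a≉0 * a) * x ≈⟨ *-assoc _ _ _ ⟩
    inverse a a≉0 * (a * x) ≈⟨ *-congˡ ax≈ay ⟩
    inverse a a≉0 * (a * y) ≈⟨ *-assoc _ _ _ ⟨
    (inverse a a≉0 * a) * y ≈⟨ *-congʳ (*-inverseˡ a a≉0) ⟩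
    1# * y                  ≈⟨ *-identityˡ y ⟩
    y                       ∎

  x*y≈0⇒y≈0 : ∀ {x y} → ¬ (x ≈ 0#) → x * y ≈ 0# → y ≈ 0#
  x*y≈0⇒y≈0 x≉0 xy≈0 = *-cancelˡ x≉0 (trans xy≈0 (sym (zeroʳ _)))

  *-nonzero : ∀ {x y} → ¬ (x ≈ 0#) → ¬ (y ≈ 0#) → ¬ (x * y ≈ 0#)
  *-nonzero x≉0 y≉0 xy≈0 = y≉0 (x*y≈0⇒y≈0 x≉0 xy≈0)

  x*y≈1⇒x≉0 : ∀ {x y} → x * y ≈ 1# → ¬ (x ≈ 0#)
  x*y≈1⇒x≉0 xy≈1 x≈0 = 1≉0 (trans (sym xy≈1) (trans (*-congʳ x≈0) (zeroˡ _)))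

  x-1≉0 : ∀ {x} → ¬ (x ≈ 1#) → ¬ (x - 1# ≈ 0#)
  x-1≉0 x≉1 x-1≈0 = x≉1 (x∙y⁻¹≈ε⇒x≈y _ _ x-1≈0)

  sum-powers-of-root : ∀ {r} N → ¬ (r ≈ 1#) → pow K r N ≈ 1# → sum {N} (λ k → pow K r (toℕ k)) ≈ 0#
  sum-powers-of-root {r} N r≉1 rᴺ≈1 = x*y≈0⇒y≈0 (x-1≉0 r≉1) (begin
    (r - 1#) * sum {N} (λ k → pow K r (toℕ k))   ≈⟨ *-comm _ _ ⟩
    sum {N} (λ k → pow K r (toℕ k)) * (r - 1#)   ≈⟨ geometric-sum r N ⟩
    pow K r N - 1#                               ≈⟨ +-congʳ rᴺ≈1 ⟩
    1# - 1#                                      ≈⟨ -‿inverseʳ 1# ⟩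
    0#                                           ∎)

module CharZeroField {c ℓ : Level} (K : CommutativeRing c ℓ) (isField : IsField K) (charZero : CharZero K) where
  open CommutativeRing K hiding (zero)
  open RingArithmetic K
  open FieldLemmas K isField public
  open import Algebra.Properties.Ring ring using (-‿injective)
  open import Data.Rational.Unnormalised as ℚᵘ using (ℚᵘ; mkℚᵘ; *≡*)
  open import Relation.Binary.Reasoning.Setoid setoid

  private
    den : ℕ → Carrier
    den d = natK K (suc d)

    den⁻¹ : ℕ → Carrier
    den⁻¹ d = inverse (den d) (charZero d)

    fromℤ-*-den : ∀ p d → fromℤ (p ℤ.* ℤ.+ suc d) ≈ fromℤ p * den d
    fromℤ-*-den p d = trans (fromℤ-homo-* p (ℤ.+ suc d)) (*-congˡ (fromℤ-+ (suc d)))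

  fromℚᵘ : ℚᵘ → Carrier
  fromℚᵘ (mkℚᵘ p d) = fromℤ p * den⁻¹ d

  fromℚᵘ-*-den : ∀ p d → fromℚᵘ (mkℚᵘ p d) * den d ≈ fromℤ p
  fromℚᵘ-*-den p d = trans (*-assoc _ _ _) (trans (*-congˡ (*-inverseˡ _ _)) (*-identityʳ _))

  fromℚᵘ-unique : ∀ p d y → y * den d ≈ fromℤ p → fromℚᵘ (mkℚᵘ p d) ≈ y
  fromℚᵘ-unique p d y y*d≈p = begin
    fromℤ p * den⁻¹ d         ≈⟨ *-congʳ y*d≈p ⟨
    (y * den d) * den⁻¹ d     ≈⟨ *-assoc _ _ _ ⟩
    y * (den d * den⁻¹ d)     ≈⟨ *-congˡ (*-inverseʳ _ _) ⟩
    y * 1#                    ≈⟨ *-identityʳ y ⟩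
    y                         ∎

  fromℚᵘ-cong : ∀ {x y} → x ℚᵘ.≃ y → fromℚᵘ x ≈ fromℚᵘ y
  fromℚᵘ-cong {mkℚᵘ p d} {mkℚᵘ q e} (*≡* pe≡qd) = fromℚᵘ-unique p d y (*-cancelˡ (charZero e) (begin
    den e * (y * den d)     ≈⟨ x∙yz≈yx∙z (den e) y (den d) ⟩
    (y * den e) * den d     ≈⟨ *-congʳ (fromℚᵘ-*-den q e) ⟩
    fromℤ q * den d         ≈⟨ fromℤ-*-den q d ⟨
    fromℤ (q ℤ.* ℤ.+ suc d) ≡⟨ ≡.cong fromℤ pe≡qd ⟨
    fromℤ (p ℤ.* ℤ.+ suc e) ≈⟨ fromℤ-*-den p e ⟩
    fromℤ p * den e         ≈⟨ *-comm _ _ ⟩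
    den e * fromℤ p         ∎))
    where
    y : Carrier
    y = fromℚᵘ (mkℚᵘ q e)
    open import Algebra.Properties.CommutativeSemigroup *-commutativeSemigroup using (x∙yz≈yx∙z)

  fromℚᵘ-homo-+ : ∀ x y → fromℚᵘ (x ℚᵘ.+ y) ≈ fromℚᵘ x + fromℚᵘ y
  fromℚᵘ-homo-+ x@(mkℚᵘ p d) y@(mkℚᵘ q e) =
    fromℚᵘ-unique (p ℤ.* ℤ.+ suc e ℤ.+ q ℤ.* ℤ.+ suc d) (ℕ.pred (suc d ℕ.* suc e)) (fromℚᵘ x + fromℚᵘ y) (begin
      (fromℚᵘ x + fromℚᵘ y) * natK K (suc d ℕ.* suc e)
        ≈⟨ *-congˡ (natK-* (suc d) (suc e)) ⟩
      (fromℚᵘ x + fromℚᵘ y) * (den d * den e)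
        ≈⟨ solve 4 (λ X Y a b → (X :+ Y) :* (a :* b) := (X :* a) :* b :+ (Y :* b) :* a) refl
                   (fromℚᵘ x) (fromℚᵘ y) (den d) (den e) ⟩
      (fromℚᵘ x * den d) * den e + (fromℚᵘ y * den e) * den d
        ≈⟨ +-cong (*-congʳ (fromℚᵘ-*-den p d)) (*-congʳ (fromℚᵘ-*-den q e)) ⟩
      fromℤ p * den e + fromℤ q * den d
        ≈⟨ +-cong (fromℤ-*-den p e) (fromℤ-*-den q d) ⟨
      fromℤ (p ℤ.* ℤ.+ suc e) + fromℤ (q ℤ.* ℤ.+ suc d)
        ≈⟨ fromℤ-homo-+ (p ℤ.* ℤ.+ suc e) (q ℤ.* ℤ.+ suc d) ⟨
      fromℤ (p ℤ.* ℤ.+ suc e ℤ.+ q ℤ.* ℤ.+ suc d)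
        ∎)
    where open Solver

  fromℚᵘ-homo-* : ∀ x y → fromℚᵘ (x ℚᵘ.* y) ≈ fromℚᵘ x * fromℚᵘ y
  fromℚᵘ-homo-* x@(mkℚᵘ p d) y@(mkℚᵘ q e) =
    fromℚᵘ-unique (p ℤ.* q) (ℕ.pred (suc d ℕ.* suc e)) (fromℚᵘ x * fromℚᵘ y) (begin
      (fromℚᵘ x * fromℚᵘ y) * natK K (suc d ℕ.* suc e) ≈⟨ *-congˡ (natK-* (suc d) (suc e)) ⟩
      (fromℚᵘ x * fromℚᵘ y) * (den d * den e)          ≈⟨ *-interchange _ _ _ _ ⟩
      (fromℚᵘ x * den d) * (fromℚᵘ y * den e)          ≈⟨ *-cong (fromℚᵘ-*-den p d) (fromℚᵘ-*-den q e) ⟩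
      fromℤ p * fromℤ q                                ≈⟨ fromℤ-homo-* p q ⟨
      fromℤ (p ℤ.* q)                                  ∎)

  fromℚᵘ-homo-neg : ∀ x → fromℚᵘ (ℚᵘ.- x) ≈ - fromℚᵘ x
  fromℚᵘ-homo-neg (mkℚᵘ p d) = trans (*-congʳ (fromℤ-homo-neg p)) (sym (-‿distribˡ-* _ _))

  fromℚ : ℚ → Carrier
  fromℚ q = fromℚᵘ (ℚ.toℚᵘ q)

  fromℚ-cong : ∀ {p q} → p ≡ q → fromℚ p ≈ fromℚ q
  fromℚ-cong ≡.refl = refl

  fromℚ-homo-+ : ∀ p q → fromℚ (p ℚ.+ q) ≈ fromℚ p + fromℚ q
  fromℚ-homo-+ p q = trans (fromℚᵘ-cong (ℚP.toℚᵘ-homo-+ p q)) (fromℚᵘ-homo-+ (ℚ.toℚᵘ p) (ℚ.toℚᵘ q))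

  fromℚ-homo-* : ∀ p q → fromℚ (p ℚ.* q) ≈ fromℚ p * fromℚ q
  fromℚ-homo-* p q = trans (fromℚᵘ-cong (ℚP.toℚᵘ-homo-* p q)) (fromℚᵘ-homo-* (ℚ.toℚᵘ p) (ℚ.toℚᵘ q))

  fromℚ-homo-neg : ∀ p → fromℚ (ℚ.- p) ≈ - fromℚ p
  fromℚ-homo-neg p = trans (fromℚᵘ-cong (ℚP.toℚᵘ-homo‿- p)) (fromℚᵘ-homo-neg (ℚ.toℚᵘ p))

  fromℚ-0 : fromℚ 0ℚ ≈ 0#
  fromℚ-0 = zeroˡ _

  fromℚ-1 : fromℚ 1ℚ ≈ 1#
  fromℚ-1 = trans (*-congʳ (fromℤ-+ 1)) (*-inverseʳ (den 0) (charZero 0))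

  fromℤ≈0⇒≡0 : ∀ i → fromℤ i ≈ 0# → i ≡ ℤ.0ℤ
  fromℤ≈0⇒≡0 (ℤ.+ zero)   _    = ≡.refl
  fromℤ≈0⇒≡0 (ℤ.+ suc k)  i≈0 = ⊥-elim (charZero k (trans (sym (fromℤ-+ (suc k))) i≈0))
  fromℤ≈0⇒≡0 ℤ.-[1+ k ]   i≈0 = ⊥-elim (charZero k (-‿injective (trans i≈0 (sym -0#≈0#))))

  fromℚ-injective : ∀ p q → fromℚ p ≈ fromℚ q → p ≡ q
  fromℚ-injective p@(ℚ.mkℚ a d _) q@(ℚ.mkℚ b e _) p≈q =
    ℚP.toℚᵘ-injective (*≡* (ℤP.i-j≡0⇒i≡j _ _ (fromℤ≈0⇒≡0 _ (begin
      fromℤ (a ℤ.* ℤ.+ suc e ℤ.- b ℤ.* ℤ.+ suc d)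
        ≈⟨ fromℤ-homo-+ (a ℤ.* ℤ.+ suc e) (ℤ.- (b ℤ.* ℤ.+ suc d)) ⟩
      fromℤ (a ℤ.* ℤ.+ suc e) + fromℤ (ℤ.- (b ℤ.* ℤ.+ suc d))
        ≈⟨ +-cong (fromℤ-*-den a e) (trans (fromℤ-homo-neg (b ℤ.* ℤ.+ suc d)) (-‿cong (fromℤ-*-den b d))) ⟩
      fromℤ a * den e - fromℤ b * den d
        ≈⟨ +-cong (*-congʳ (fromℚᵘ-*-den a d)) (-‿cong (*-congʳ (fromℚᵘ-*-den b e))) ⟨
      (fromℚ p * den d) * den e - (fromℚ q * den e) * den d
        ≈⟨ +-congˡ (-‿cong (*-congʳ (*-congʳ p≈q))) ⟨
      (fromℚ p * den d) * den e - (fromℚ p * den e) * den d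
        ≈⟨ solve 3 (λ x a b → (x :* a) :* b :- (x :* b) :* a := con (ℤ.+ 0)) refl (fromℚ p) (den d) (den e) ⟩
      0#
        ∎))))
    where open Solver

  fromℚ-natK : ∀ k → fromℚ (natK ℚ-ring k) ≈ natK K k
  fromℚ-natK zero    = fromℚ-0
  fromℚ-natK (suc k) = trans (fromℚ-homo-+ 1ℚ (natK ℚ-ring k)) (+-cong fromℚ-1 (fromℚ-natK k))

  fromℚ-pow : ∀ q k → fromℚ (pow ℚ-ring q k) ≈ pow K (fromℚ q) k
  fromℚ-pow q zero    = fromℚ-1
  fromℚ-pow q (suc k) = trans (fromℚ-homo-* q (pow ℚ-ring q k)) (*-congˡ (fromℚ-pow q k))

  fromℚ-sum : ∀ {N} (f : Fin N → ℚ) → fromℚ (RingArithmetic.sum ℚ-ring f) ≈ sum (λ i → fromℚ (f i))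
  fromℚ-sum {zero}  f = fromℚ-0
  fromℚ-sum {suc N} f = trans (fromℚ-homo-+ (f Fin.zero) (RingArithmetic.sum ℚ-ring (λ i → f (Fin.suc i)))) (+-congˡ (fromℚ-sum (λ i → f (Fin.suc i))))

  fromℚ-polyG7 : ∀ h α β q → fromℚ (polyG7 ℚ-ring h α β q) ≈ polyG7 K h α β (fromℚ q)
  fromℚ-polyG7 h α β q =
    +-hom S₅ (natK ℚ-ring 2)
      (+-hom S₄ (T 2 e₆)
        (−-hom S₃ (T 2 e₅)
          (+-hom S₂ (T 2 e₄)
            (+-hom S₁ (T 2 e₃)
              (+-hom (T 3 e₁) (T 3 e₂) (term 3 e₁) (term 3 e₂))
              (term 2 e₃))
            (term 2 e₄))
          (term 2 e₅))
        (term 2 e₆))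
      (fromℚ-natK 2)
    where
    e₁ e₂ e₃ e₄ e₅ e₆ : ℕ
    e₁ = 2 ℕ.* α ℕ.+ β ℕ.+ h
    e₂ = β ℕ.+ h
    e₃ = 2 ℕ.* α ℕ.+ 2 ℕ.* β
    e₄ = 2 ℕ.* α
    e₅ = α ℕ.+ β
    e₆ = 2 ℕ.* β
    T : ℕ → ℕ → ℚ
    T c k = natK ℚ-ring c ℚ.* pow ℚ-ring q k
    S₁ S₂ S₃ S₄ S₅ : ℚ
    S₁ = T 3 e₁ ℚ.+ T 3 e₂
    S₂ = S₁ ℚ.+ T 2 e₃
    S₃ = S₂ ℚ.+ T 2 e₄
    S₄ = S₃ ℚ.- T 2 e₅
    S₅ = S₄ ℚ.+ T 2 e₆
    term : ∀ c k → fromℚ (T c k) ≈ natK K c * pow K (fromℚ q) k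
    term c k = trans (fromℚ-homo-* (natK ℚ-ring c) (pow ℚ-ring q k))
                     (*-cong (fromℚ-natK c) (fromℚ-pow q k))
    +-hom : ∀ x y {x′ y′} → fromℚ x ≈ x′ → fromℚ y ≈ y′ → fromℚ (x ℚ.+ y) ≈ x′ + y′
    +-hom x y x≈ y≈ = trans (fromℚ-homo-+ x y) (+-cong x≈ y≈)
    −-hom : ∀ x y {x′ y′} → fromℚ x ≈ x′ → fromℚ y ≈ y′ → fromℚ (x ℚ.- y) ≈ x′ - y′
    −-hom x y x≈ y≈ = trans (fromℚ-homo-+ x (ℚ.- y)) (+-cong x≈ (trans (fromℚ-homo-neg y) (-‿cong y≈)))

module LinearDependence {c ℓ : Level} (K : CommutativeRing c ℓ) (isField : IsField K)
                        (_≟_ : ∀ x y → Dec (CommutativeRing._≈_ K x y)) where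
  open CommutativeRing K hiding (zero)
  open RingArithmetic K
  open FieldLemmas K isField
  open import Data.Fin using (punchIn; punchOut)
  open import Relation.Nullary using (¬?)
  open import Relation.Binary.Reasoning.Setoid setoid

  Dependent : ∀ {k m} → (Fin k → Fin m → Carrier) → Set (c Level.⊔ ℓ)
  Dependent {k} vs = Σ (Fin k → Carrier) λ coeff →
    (∃ λ i → ¬ (coeff i ≈ 0#)) × (∀ r → sum (λ i → coeff i * vs i r) ≈ 0#)

  private
    without-pivot : ∀ m (vs : Fin (suc (suc m)) → Fin (suc m) → Carrier) → (∀ i → vs i Fin.zero ≈ 0#) →
                    Dependent (λ k r → vs (Fin.suc k) (Fin.suc r)) → Dependent vs
    without-pivot m vs vs₀≈0 (coeff′ , (k , coeff′k≉0) , rel′) = coeff , (Fin.suc k , coeff′k≉0) , rel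
      where
      coeff : Fin (suc (suc m)) → Carrier
      coeff Fin.zero    = 0#
      coeff (Fin.suc k) = coeff′ k
      rel : ∀ r → sum (λ i → coeff i * vs i r) ≈ 0#
      rel Fin.zero    = trans (+-cong (zeroˡ _) (sum-zero (λ k → coeff′ k * vs (Fin.suc k) Fin.zero) λ k → trans (*-congˡ (vs₀≈0 (Fin.suc k))) (zeroʳ _)))
                              (+-identityˡ _)
      rel (Fin.suc r) = trans (+-cong (zeroˡ _) (rel′ r)) (+-identityˡ _)

    module Pivot (m : ℕ) (vs : Fin (suc (suc m)) → Fin (suc m) → Carrier) (p : Fin (suc (suc m))) (a≉0 : ¬ (vs p Fin.zero ≈ 0#)) where
      t : Fin (suc (suc m)) → Carrier
      t i = vs i Fin.zero * inverse (vs p Fin.zero) a≉0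

      reduced : Fin (suc (suc m)) → Fin (suc m) → Carrier
      reduced i r = vs i r - t i * vs p r

      reduced₀≈0 : ∀ i → reduced i Fin.zero ≈ 0#
      reduced₀≈0 i = begin
        vs i Fin.zero - t i * vs p Fin.zero   ≈⟨ +-congˡ (-‿cong (trans (*-assoc _ _ _) (trans (*-congˡ (*-inverseˡ _ a≉0)) (*-identityʳ _)))) ⟩
        vs i Fin.zero - vs i Fin.zero         ≈⟨ -‿inverseʳ _ ⟩
        0#                                    ∎

      with-pivot : Dependent (λ k r → reduced (punchIn p k) (Fin.suc r)) → Dependent vs
      with-pivot (coeff′ , (k₀ , coeff′k₀≉0) , rel′) = coeff , (punchIn p k₀ , coeff-k₀≉0) , rel
        where
        coeffₚ : Carrier
        coeffₚ = - sum (λ k → coeff′ k * t (punchIn p k))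

        coeff : Fin (suc (suc m)) → Carrier
        coeff i with i FinP.≟ p
        ... | yes _   = coeffₚ
        ... | no  i≢p = coeff′ (punchOut (i≢p ∘ ≡.sym))
          where open import Function using (_∘_)

        coeff-p : coeff p ≈ coeffₚ
        coeff-p with p FinP.≟ p
        ... | yes _   = refl
        ... | no  p≢p = ⊥-elim (p≢p ≡.refl)

        coeff-punchIn : ∀ k → coeff (punchIn p k) ≈ coeff′ k
        coeff-punchIn k with punchIn p k FinP.≟ p
        ... | yes eq = ⊥-elim (FinP.punchInᵢ≢i p k eq)
        ... | no  _  = ≡⇒≈ (≡.cong coeff′ (≡.trans (FinP.punchOut-cong p ≡.refl) (FinP.punchOut-punchIn p)))

        coeff-k₀≉0 : ¬ (coeff (punchIn p k₀) ≈ 0#)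
        coeff-k₀≉0 eq = coeff′k₀≉0 (trans (sym (coeff-punchIn k₀)) eq)

        rel-reduced : ∀ r → sum (λ k → coeff′ k * reduced (punchIn p k) r) ≈ 0#
        rel-reduced Fin.zero    = sum-zero (λ k → coeff′ k * reduced (punchIn p k) Fin.zero) λ k → trans (*-congˡ (reduced₀≈0 (punchIn p k))) (zeroʳ _)
        rel-reduced (Fin.suc r) = rel′ r

        expand : ∀ r → sum (λ k → coeff′ k * reduced (punchIn p k) r)
                       ≈ coeffₚ * vs p r + sum (λ k → coeff′ k * vs (punchIn p k) r)
        expand r = begin
          sum (λ k → coeff′ k * reduced (punchIn p k) r)
            ≈⟨ sum-cong-≋ (λ k → expand-term (coeff′ k) (vs (punchIn p k) r) (t (punchIn p k)) (vs p r)) ⟩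
          sum (λ k → X k + Y k * vs p r)
            ≈⟨ ∑-distrib-+ X (λ k → Y k * vs p r) ⟩
          sum X + sum (λ k → Y k * vs p r)
            ≈⟨ +-congˡ (*-distribʳ-sum (vs p r) Y) ⟨
          sum X + sum Y * vs p r
            ≈⟨ +-congˡ (*-congʳ (sum-neg (λ k → coeff′ k * t (punchIn p k)))) ⟩
          sum X + coeffₚ * vs p r
            ≈⟨ +-comm _ _ ⟩
          coeffₚ * vs p r + sum X
            ∎
          where
          X Y : Fin (suc m) → Carrier
          X k = coeff′ k * vs (punchIn p k) r
          Y k = - (coeff′ k * t (punchIn p k))
          expand-term : ∀ c x t v → c * (x - t * v) ≈ c * x + - (c * t) * v
          expand-term = solve 4 (λ c x t v → c :* (x :- t :* v) := c :* x :+ :- (c :* t) :* v) refl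
            where open Solver

        rel : ∀ r → sum (λ i → coeff i * vs i r) ≈ 0#
        rel r = begin
          sum (λ i → coeff i * vs i r)
            ≈⟨ sum-remove {i = p} (λ i → coeff i * vs i r) ⟩
          coeff p * vs p r + sum (λ k → coeff (punchIn p k) * vs (punchIn p k) r)
            ≈⟨ +-cong (*-congʳ coeff-p) (sum-cong-≋ λ k → *-congʳ {vs (punchIn p k) r} (coeff-punchIn k)) ⟩
          coeffₚ * vs p r + sum (λ k → coeff′ k * vs (punchIn p k) r)
            ≈⟨ expand r ⟨
          sum (λ k → coeff′ k * reduced (punchIn p k) r)
            ≈⟨ rel-reduced r ⟩
          0#
            ∎

  dependent : ∀ m (vs : Fin (suc m) → Fin m → Carrier) → Dependent vs
  dependent zero    vs = (λ _ → 1#) , (Fin.zero , 1≉0) , λ ()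
  dependent (suc m) vs with FinP.any? (λ p → ¬? (vs p Fin.zero ≟ 0#))
  ... | yes (p , a≉0) = with-pivot (dependent m (λ k r → reduced (punchIn p k) (Fin.suc r)))
    where open Pivot m vs p a≉0
  ... | no  no-pivot  = without-pivot m vs vs₀≈0 (dependent m (λ k r → vs (Fin.suc k) (Fin.suc r)))
    where
    vs₀≈0 : ∀ i → vs i Fin.zero ≈ 0#
    vs₀≈0 i with vs i Fin.zero ≟ 0#
    ... | yes eq  = eq
    ... | no  neq = ⊥-elim (no-pivot (i , neq))

module RationalNumbers where
  open import Relation.Binary.Definitions using (tri<; tri≈; tri>)
  open ≡.≡-Reasoning

  -1ℚ : ℚ
  -1ℚ = ℚ.- 1ℚ

  ℚ-isField : IsField ℚ-ring
  ℚ-isField = (λ ()) , λ x x≢0 → ℚ.1/_ x {{ℚ.≢-nonZero x≢0}} , ℚP.*-inverseʳ x {{ℚ.≢-nonZero x≢0}}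

  ℚ-charZero : CharZero ℚ-ring
  ℚ-charZero k natK≡0 = ℚP.<-irrefl (≡.sym natK≡0) (natK-pos k)
    where
    natK-pos : ∀ k → 0ℚ ℚ.< natK ℚ-ring (suc k)
    natK-pos zero    = ℚP.positive⁻¹ 1ℚ
    natK-pos (suc k) = ℚP.+-mono-< (ℚP.positive⁻¹ 1ℚ) (natK-pos k)

  open FieldLemmas ℚ-ring ℚ-isField public
    using () renaming (x*y≈0⇒y≈0 to x*y≡0⇒y≡0; *-nonzero to x≢0∧y≢0⇒x*y≢0)

  private
    pow-≤ : ∀ {μ} k → 0ℚ ℚ.≤ μ → μ ℚ.≤ 1ℚ → pow ℚ-ring μ (suc k) ℚ.≤ μ
    pow-≤ zero    0≤μ μ≤1 = ℚP.≤-reflexive (ℚP.*-identityʳ _)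
    pow-≤ {μ} (suc k) 0≤μ μ≤1 = ℚP.≤-trans (ℚP.*-monoˡ-≤-nonNeg μ {{ℚ.nonNegative 0≤μ}} (ℚP.≤-trans (pow-≤ k 0≤μ μ≤1) μ≤1))
                                          (ℚP.≤-reflexive (ℚP.*-identityʳ μ))

    pow-≥ : ∀ {μ} k → 1ℚ ℚ.≤ μ → μ ℚ.≤ pow ℚ-ring μ (suc k)
    pow-≥ zero    1≤μ = ℚP.≤-reflexive (≡.sym (ℚP.*-identityʳ _))
    pow-≥ {μ} (suc k) 1≤μ = ℚP.≤-trans (ℚP.≤-reflexive (≡.sym (ℚP.*-identityʳ μ)))
                                      (ℚP.*-monoˡ-≤-nonNeg μ {{ℚ.nonNegative 0≤μ}} (ℚP.≤-trans 1≤μ (pow-≥ k 1≤μ)))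
      where
      0≤μ : 0ℚ ℚ.≤ μ
      0≤μ = ℚP.≤-trans (ℚP.<⇒≤ (ℚP.positive⁻¹ 1ℚ)) 1≤μ

    nonneg-root-of-unity : ∀ {μ} k → 0ℚ ℚ.≤ μ → pow ℚ-ring μ (suc k) ≡ 1ℚ → μ ≡ 1ℚ
    nonneg-root-of-unity {μ} k 0≤μ μᵏ≡1 with ℚP.<-cmp μ 1ℚ
    ... | tri< μ<1 _ _ = ⊥-elim (ℚP.<-irrefl ≡.refl (ℚP.≤-<-trans (ℚP.≤-trans (ℚP.≤-reflexive (≡.sym μᵏ≡1)) (pow-≤ k 0≤μ (ℚP.<⇒≤ μ<1))) μ<1))
    ... | tri≈ _ μ≡1 _ = μ≡1
    ... | tri> _ _ 1<μ = ⊥-elim (ℚP.<-irrefl ≡.refl (ℚP.<-≤-trans 1<μ (ℚP.≤-trans (pow-≥ k (ℚP.<⇒≤ 1<μ)) (ℚP.≤-reflexive μᵏ≡1))))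

    ∣pow∣ : ∀ x k → ℚ.∣ pow ℚ-ring x k ∣ ≡ pow ℚ-ring ℚ.∣ x ∣ k
    ∣pow∣ x zero    = ≡.refl
    ∣pow∣ x (suc k) = ≡.trans (ℚP.∣p*q∣≡∣p∣*∣q∣ x _) (≡.cong (ℚ.∣ x ∣ ℚ.*_) (∣pow∣ x k))

  root-of-unity : ∀ {x} k → pow ℚ-ring x (suc k) ≡ 1ℚ → x ≡ 1ℚ ⊎ x ≡ -1ℚ
  root-of-unity {x} k xᵏ≡1 = from-abs (ℚP.∣p∣≡p∨∣p∣≡-p x)
    where
    ∣x∣≡1 : ℚ.∣ x ∣ ≡ 1ℚ
    ∣x∣≡1 = nonneg-root-of-unity k (ℚP.0≤∣p∣ x) (≡.trans (≡.sym (∣pow∣ x (suc k))) (≡.cong ℚ.∣_∣ xᵏ≡1))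
    from-abs : ℚ.∣ x ∣ ≡ x ⊎ ℚ.∣ x ∣ ≡ ℚ.- x → x ≡ 1ℚ ⊎ x ≡ -1ℚ
    from-abs (inj₁ ∣x∣≡x)  = inj₁ (≡.trans (≡.sym ∣x∣≡x) ∣x∣≡1)
    from-abs (inj₂ ∣x∣≡-x) = inj₂ (begin
      x          ≡⟨ RingArithmetic.-‿involutive ℚ-ring x ⟨
      ℚ.- ℚ.- x  ≡⟨ ≡.cong ℚ.-_ (≡.trans (≡.sym ∣x∣≡-x) ∣x∣≡1) ⟩
      -1ℚ        ∎)

  IsSign : ℚ → Set
  IsSign s = s ≡ 1ℚ ⊎ s ≡ -1ℚ

  pow-1-sign : ∀ k → IsSign (pow ℚ-ring -1ℚ k)
  pow-1-sign zero    = inj₁ ≡.refl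
  pow-1-sign (suc k) with pow-1-sign k
  ... | inj₁ eq = inj₂ (≡.cong (-1ℚ ℚ.*_) eq)
  ... | inj₂ eq = inj₁ (≡.cong (-1ℚ ℚ.*_) eq)

  sign-nonzero : ∀ {s} → IsSign s → s ≢ 0ℚ
  sign-nonzero (inj₁ ≡.refl) ()
  sign-nonzero (inj₂ ≡.refl) ()

  sign*sign : ∀ {s} → IsSign s → s ℚ.* s ≡ 1ℚ
  sign*sign (inj₁ ≡.refl) = ≡.refl
  sign*sign (inj₂ ≡.refl) = ≡.refl

  sign-inverse : ∀ {s t} → IsSign s → s ℚ.* t ≡ 1ℚ → t ≡ s
  sign-inverse {s} {t} s±1 st≡1 = begin
    t                ≡⟨ ℚP.*-identityˡ t ⟨
    1ℚ ℚ.* t         ≡⟨ ≡.cong (ℚ._* t) (sign*sign s±1) ⟨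
    s ℚ.* s ℚ.* t    ≡⟨ ℚP.*-assoc s s t ⟩
    s ℚ.* (s ℚ.* t)  ≡⟨ ≡.cong (s ℚ.*_) st≡1 ⟩
    s ℚ.* 1ℚ         ≡⟨ ℚP.*-identityʳ s ⟩
    s                ∎

module Cyclic (m : ℕ) where
  open import Data.Nat.DivMod
  open import Data.Fin.Permutation using (Permutation′; permutation)
  open import Data.Nat.Divisibility using (_∣_; divides; ∣⇒≤)
  open ≡.≡-Reasoning

  n : ℕ
  n = suc m

  infixl 6 _⊕_ _⊖_

  _⊕_ : Fin n → ℕ → Fin n
  j ⊕ k = addMod j k

  -- j − a, meaningful for a ≤ n only
  _⊖_ : Fin n → ℕ → Fin n
  j ⊖ a = j ⊕ (n ℕ.∸ a)

  toℕ-⊕ : ∀ j k → toℕ (j ⊕ k) ≡ (toℕ j ℕ.+ k) % n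
  toℕ-⊕ j k = FinP.toℕ-fromℕ< (m%n<n (toℕ j ℕ.+ k) n)

  ⊕-+ : ∀ j a b → j ⊕ a ⊕ b ≡ j ⊕ (a ℕ.+ b)
  ⊕-+ j a b = FinP.toℕ-injective (begin
    toℕ (j ⊕ a ⊕ b)                                   ≡⟨ toℕ-⊕ (j ⊕ a) b ⟩
    (toℕ (j ⊕ a) ℕ.+ b) % n                           ≡⟨ ≡.cong (λ t → (t ℕ.+ b) % n) (toℕ-⊕ j a) ⟩
    ((toℕ j ℕ.+ a) % n ℕ.+ b) % n                     ≡⟨ %-distribˡ-+ ((toℕ j ℕ.+ a) % n) b n ⟩
    ((toℕ j ℕ.+ a) % n % n ℕ.+ b % n) % n             ≡⟨ ≡.cong (λ t → (t ℕ.+ b % n) % n) (m%n%n≡m%n (toℕ j ℕ.+ a) n) ⟩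
    ((toℕ j ℕ.+ a) % n ℕ.+ b % n) % n                 ≡⟨ %-distribˡ-+ (toℕ j ℕ.+ a) b n ⟨
    (toℕ j ℕ.+ a ℕ.+ b) % n                           ≡⟨ ≡.cong (_% n) (ℕP.+-assoc (toℕ j) a b) ⟩
    (toℕ j ℕ.+ (a ℕ.+ b)) % n                         ≡⟨ toℕ-⊕ j (a ℕ.+ b) ⟨
    toℕ (j ⊕ (a ℕ.+ b))                               ∎)

  ⊕-0 : ∀ j → j ⊕ 0 ≡ j
  ⊕-0 j = FinP.toℕ-injective (≡.trans (toℕ-⊕ j 0)
            (≡.trans (≡.cong (_% n) (ℕP.+-identityʳ (toℕ j))) (m<n⇒m%n≡m (FinP.toℕ<n j))))

  ⊕-n : ∀ j → j ⊕ n ≡ j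
  ⊕-n j = FinP.toℕ-injective (≡.trans (toℕ-⊕ j n)
            (≡.trans ([m+n]%n≡m%n (toℕ j) n) (m<n⇒m%n≡m (FinP.toℕ<n j))))

  ⊕-comm : ∀ j a b → j ⊕ a ⊕ b ≡ j ⊕ b ⊕ a
  ⊕-comm j a b = ≡.trans (⊕-+ j a b) (≡.trans (≡.cong (j ⊕_) (ℕP.+-comm a b)) (≡.sym (⊕-+ j b a)))

  ⊕-⊖ : ∀ {a} → a ℕ.≤ n → ∀ j → j ⊕ a ⊖ a ≡ j
  ⊕-⊖ {a} a≤n j = ≡.trans (⊕-+ j a (n ℕ.∸ a)) (≡.trans (≡.cong (j ⊕_) (ℕP.m+[n∸m]≡n a≤n)) (⊕-n j))

  ⊖-⊕ : ∀ {a} → a ℕ.≤ n → ∀ j → j ⊖ a ⊕ a ≡ j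
  ⊖-⊕ {a} a≤n j = ≡.trans (⊕-+ j (n ℕ.∸ a) a) (≡.trans (≡.cong (j ⊕_) (ℕP.m∸n+n≡m a≤n)) (⊕-n j))

  shift : ∀ a → a ℕ.≤ n → Permutation′ n
  shift a a≤n = permutation (_⊕ a) (_⊖ a) (⊖-⊕ a≤n) (⊕-⊖ a≤n)

  ⊕-fixes⇒∣ : ∀ j k → j ⊕ k ≡ j → n ∣ k
  ⊕-fixes⇒∣ j k j⊕k≡j = divides ((toℕ j ℕ.+ k) / n) (ℕP.+-cancelˡ-≡ (toℕ j) k _ (begin
    toℕ j ℕ.+ k                                       ≡⟨ m≡m%n+[m/n]*n (toℕ j ℕ.+ k) n ⟩
    (toℕ j ℕ.+ k) % n ℕ.+ (toℕ j ℕ.+ k) / n ℕ.* n     ≡⟨ ≡.cong (ℕ._+ (toℕ j ℕ.+ k) / n ℕ.* n) (≡.trans (≡.sym (toℕ-⊕ j k)) (≡.cong toℕ j⊕k≡j)) ⟩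
    toℕ j ℕ.+ (toℕ j ℕ.+ k) / n ℕ.* n                 ∎))

  ⊕≢⊖ : ∀ {a} → 0 ℕ.< a → a ℕ.+ a ℕ.< n → ∀ j → j ⊕ a ≢ j ⊖ a
  ⊕≢⊖ {a} 0<a 2a<n j j⊕a≡j⊖a = ℕP.<⇒≱ 2a<n (∣⇒≤ {{ℕ.>-nonZero (ℕP.<-≤-trans 0<a (ℕP.m≤m+n a a))}} (⊕-fixes⇒∣ (j ⊖ a) (a ℕ.+ a) (begin
    j ⊖ a ⊕ (a ℕ.+ a)    ≡⟨ ⊕-+ (j ⊖ a) a a ⟨
    j ⊖ a ⊕ a ⊕ a        ≡⟨ ≡.cong (_⊕ a) (⊖-⊕ a≤n j) ⟩
    j ⊕ a                ≡⟨ j⊕a≡j⊖a ⟩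
    j ⊖ a                ∎)))
    where
    a≤n : a ℕ.≤ n
    a≤n = ℕP.≤-trans (ℕP.m≤m+n a a) (ℕP.<⇒≤ 2a<n)

module DiscreteFourier {c ℓ : Level} (R : CommutativeRing c ℓ) (m : ℕ) (z : CommutativeRing.Carrier R)
                       (zⁿ≈1 : CommutativeRing._≈_ R (pow R z (suc m)) (CommutativeRing.1# R)) where
  open CommutativeRing R hiding (zero)
  open RingArithmetic R
  open Cyclic m
  open import Relation.Binary.Reasoning.Setoid setoid

  -- w is z⁻¹: z * w is definitionally pow R z n.
  w : Carrier
  w = pow R z m

  fourier : (Fin n → Carrier) → Carrier
  fourier F = sum (λ j → F j * pow R w (toℕ j))

  fourier-cong : ∀ {F G} → (∀ j → F j ≈ G j) → fourier F ≈ fourier G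
  fourier-cong {F} {G} F≈G = sum-cong-≋ (λ j → *-congʳ {pow R w (toℕ j)} (F≈G j))

  fourier-+ : ∀ F G → fourier (λ j → F j + G j) ≈ fourier F + fourier G
  fourier-+ F G = trans (sum-cong-≋ (λ j → distribʳ (pow R w (toℕ j)) (F j) (G j)))
                        (∑-distrib-+ (λ j → F j * pow R w (toℕ j)) (λ j → G j * pow R w (toℕ j)))

  fourier-* : ∀ k F → fourier (λ j → k * F j) ≈ k * fourier F
  fourier-* k F = trans (sum-cong-≋ (λ j → *-assoc k (F j) (pow R w (toℕ j))))
                        (sym (*-distribˡ-sum k (λ j → F j * pow R w (toℕ j))))

  fourier-neg : ∀ F → fourier (λ j → - F j) ≈ - fourier F
  fourier-neg F = trans (sum-cong-≋ (λ j → sym (-‿distribˡ-* (F j) (pow R w (toℕ j)))))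
                        (sum-neg (λ j → F j * pow R w (toℕ j)))

  fourier-zero : ∀ F → (∀ j → F j ≈ 0#) → fourier F ≈ 0#
  fourier-zero F F≈0 = sum-zero (λ j → F j * pow R w (toℕ j)) (λ j → trans (*-congʳ (F≈0 j)) (zeroˡ _))

  fourier-lincomb : ∀ {N} (k : Fin N → Carrier) (V : Fin N → Fin n → Carrier) →
                    fourier (λ j → sum (λ r → k r * V r j)) ≈ sum (λ r → k r * fourier (V r))
  fourier-lincomb k V = begin
    sum (λ j → sum (λ r → k r * V r j) * pow R w (toℕ j))    ≈⟨ sum-cong-≋ (λ j → *-distribʳ-sum (pow R w (toℕ j)) (λ r → k r * V r j)) ⟩
    sum (λ j → sum (λ r → (k r * V r j) * pow R w (toℕ j)))  ≈⟨ ∑-comm (λ j r → (k r * V r j) * pow R w (toℕ j)) ⟩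
    sum (λ r → sum (λ j → (k r * V r j) * pow R w (toℕ j)))  ≈⟨ sum-cong-≋ (λ r → fourier-* (k r) (V r)) ⟩
    sum (λ r → k r * fourier (V r))                           ∎

  fourier-shift : ∀ {a} → a ℕ.≤ n → ∀ F → fourier (λ j → F (j ⊕ a)) ≈ pow R z a * fourier F
  fourier-shift {a} a≤n F = begin
    sum (λ j → F (j ⊕ a) * pow R w (toℕ j))   ≈⟨ sum-cong-≋ term ⟩
    sum (λ j → pow R z a * G (j ⊕ a))         ≈⟨ *-distribˡ-sum (pow R z a) (λ j → G (j ⊕ a)) ⟨
    pow R z a * sum (λ j → G (j ⊕ a))         ≈⟨ *-congˡ (sum-permute G (shift a a≤n)) ⟨
    pow R z a * fourier F                     ∎
    where
    G : Fin n → Carrier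
    G i = F i * pow R w (toℕ i)
    wⁿ≈1 : pow R w n ≈ 1#
    wⁿ≈1 = pow-pow-root n m zⁿ≈1
    zᵃwᵃ≈1 : pow R z a * pow R w a ≈ 1#
    zᵃwᵃ≈1 = trans (sym (pow-distrib-* z w a)) (trans (pow-cong a zⁿ≈1) (1-pow a))
    term : ∀ j → F (j ⊕ a) * pow R w (toℕ j) ≈ pow R z a * G (j ⊕ a)
    term j = sym (begin
      pow R z a * (F (j ⊕ a) * pow R w (toℕ (j ⊕ a)))       ≡⟨ ≡.cong (λ k → pow R z a * (F (j ⊕ a) * pow R w k)) (toℕ-⊕ j a) ⟩
      pow R z a * (F (j ⊕ a) * pow R w ((toℕ j ℕ.+ a) % n)) ≈⟨ *-congˡ (*-congˡ (pow-mod n wⁿ≈1 (toℕ j ℕ.+ a))) ⟩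
      pow R z a * (F (j ⊕ a) * pow R w (toℕ j ℕ.+ a))       ≈⟨ *-congˡ (*-congˡ (pow-+ w (toℕ j) a)) ⟩
      pow R z a * (F (j ⊕ a) * (pow R w (toℕ j) * pow R w a)) ≈⟨ rearrange (pow R z a) (F (j ⊕ a)) (pow R w (toℕ j)) (pow R w a) ⟩
      F (j ⊕ a) * pow R w (toℕ j) * (pow R z a * pow R w a) ≈⟨ *-congˡ zᵃwᵃ≈1 ⟩
      F (j ⊕ a) * pow R w (toℕ j) * 1#                      ≈⟨ *-identityʳ _ ⟩
      F (j ⊕ a) * pow R w (toℕ j)                           ∎)
      where
      open import Data.Nat.DivMod using (_%_)
      open Solver
      rearrange : ∀ p f q r → p * (f * (q * r)) ≈ f * q * (p * r)
      rearrange = solve 4 (λ p f q r → p :* (f :* (q :* r)) := f :* q :* (p :* r)) refl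

  δ₀ : Fin n → Carrier
  δ₀ Fin.zero    = 1#
  δ₀ (Fin.suc _) = 0#

  fourier-δ₀ : fourier δ₀ ≈ 1#
  fourier-δ₀ = trans (sum-δ (λ j → δ₀ j * pow R w (toℕ j)) Fin.zero (λ { Fin.zero 0≢0 → ⊥-elim (0≢0 ≡.refl)
                                                                      ; (Fin.suc j) _ → zeroˡ _ }))
                     (*-identityˡ 1#)

  fourier-+shift : ∀ F → fourier (λ j → F j + F (j ⊕ 1)) ≈ (1# + z) * fourier F
  fourier-+shift F = begin
    fourier (λ j → F j + F (j ⊕ 1))        ≈⟨ fourier-+ F (λ j → F (j ⊕ 1)) ⟩
    fourier F + fourier (λ j → F (j ⊕ 1))  ≈⟨ +-cong (sym (*-identityˡ _)) (fourier-shift (ℕ.s≤s ℕ.z≤n) F) ⟩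
    1# * fourier F + z * 1# * fourier F    ≈⟨ +-congˡ (*-congʳ (*-identityʳ z)) ⟩
    1# * fourier F + z * fourier F         ≈⟨ distribʳ _ _ _ ⟨
    (1# + z) * fourier F                   ∎

module ReducedOperator {c ℓ : Level} (R : CommutativeRing c ℓ) (m h α β : ℕ) where
  open CommutativeRing R hiding (zero)
  open RingArithmetic R
  open Cyclic m public
  open import Relation.Binary.Reasoning.Setoid setoid

  2# : Carrier
  2# = natK R 2

  -- With x_d = x_e = D, the b-, c-, d-, e-, f- and g-rows of the adjacency matrix
  -- force x_b = x_g = xb D, x_f = xf D, x_c = xc D and x_a = xa D; the a-rows then
  -- read L D = 0.
  xf xc xa xb L : (Fin n → Carrier) → Fin n → Carrier
  xf D j = 2# * D (j ⊕ β) + 2# * D (j ⊖ β)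
  xc D j = - D (j ⊕ h) - xf D j
  xa D j = 2# * D (j ⊕ h) - xc D j
  xb D j = - (2# * D j)
  L D j = xa D (j ⊕ α) + xa D (j ⊖ α) + xb D j

  symbolF symbolC symbolA symbol : Carrier → Carrier
  symbolF z = 2# * pow R z β + 2# * pow R z (n ℕ.∸ β)
  symbolC z = - pow R z h - symbolF z
  symbolA z = 2# * pow R z h - symbolC z
  symbol  z = pow R z α * symbolA z + pow R z (n ℕ.∸ α) * symbolA z - 2#

  private
    module Factor where
      open Solver
      xf-factor : ∀ p q d → 2# * (p * d) + 2# * (q * d) ≈ (2# * p + 2# * q) * d
      xf-factor = solve 3 (λ p q d → con (ℤ.+ 2) :* (p :* d) :+ con (ℤ.+ 2) :* (q :* d)
                                     := (con (ℤ.+ 2) :* p :+ con (ℤ.+ 2) :* q) :* d) refl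
      xc-factor : ∀ p q d → - (p * d) - q * d ≈ (- p - q) * d
      xc-factor = solve 3 (λ p q d → :- (p :* d) :- q :* d := (:- p :- q) :* d) refl
      xa-factor : ∀ p q d → 2# * (p * d) - q * d ≈ (2# * p - q) * d
      xa-factor = solve 3 (λ p q d → con (ℤ.+ 2) :* (p :* d) :- q :* d := (con (ℤ.+ 2) :* p :- q) :* d) refl
      L-factor : ∀ p q a d → p * (a * d) + q * (a * d) - 2# * d ≈ (p * a + q * a - 2#) * d
      L-factor = solve 4 (λ p q a d → p :* (a :* d) :+ q :* (a :* d) :- con (ℤ.+ 2) :* d
                                      := (p :* a :+ q :* a :- con (ℤ.+ 2)) :* d) refl
  open Factor

  module Eigenvector (μ : Carrier) (D : Fin n → Carrier) (D-eigen : ∀ j k → D (j ⊕ k) ≈ pow R μ k * D j) where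
    xf-eigen : ∀ j → xf D j ≈ symbolF μ * D j
    xf-eigen j = trans (+-cong (*-congˡ (D-eigen j β)) (*-congˡ (D-eigen j (n ℕ.∸ β)))) (xf-factor _ _ _)

    xc-eigen : ∀ j → xc D j ≈ symbolC μ * D j
    xc-eigen j = trans (+-cong (-‿cong (D-eigen j h)) (-‿cong (xf-eigen j))) (xc-factor _ _ _)

    xa-eigen : ∀ j → xa D j ≈ symbolA μ * D j
    xa-eigen j = trans (+-cong (*-congˡ (D-eigen j h)) (-‿cong (xc-eigen j))) (xa-factor _ _ _)

    L-eigen : ∀ j → L D j ≈ symbol μ * D j
    L-eigen j = begin
      xa D (j ⊕ α) + xa D (j ⊖ α) + xb D j
        ≈⟨ +-congʳ (+-cong (xa-eigen (j ⊕ α)) (xa-eigen (j ⊖ α))) ⟩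
      symbolA μ * D (j ⊕ α) + symbolA μ * D (j ⊖ α) + xb D j
        ≈⟨ +-congʳ (+-cong (*-congˡ (D-eigen j α)) (*-congˡ (D-eigen j (n ℕ.∸ α)))) ⟩
      symbolA μ * (pow R μ α * D j) + symbolA μ * (pow R μ (n ℕ.∸ α) * D j) + xb D j
        ≈⟨ +-congʳ (+-cong (x∙yz≈y∙xz _ _ _) (x∙yz≈y∙xz _ _ _)) ⟩
      pow R μ α * (symbolA μ * D j) + pow R μ (n ℕ.∸ α) * (symbolA μ * D j) + xb D j
        ≈⟨ L-factor _ _ _ _ ⟩
      symbol μ * D j
        ∎
      where open import Algebra.Properties.CommutativeSemigroup *-commutativeSemigroup using (x∙yz≈y∙xz)

  module Linearity where
    open Solver

    xf-linear : ∀ k D E j → xf (λ i → k * D i + E i) j ≈ k * xf D j + xf E j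
    xf-linear k D E j = solve 6 (λ t k p q r s → t :* (k :* p :+ q) :+ t :* (k :* r :+ s)
                                               := k :* (t :* p :+ t :* r) :+ (t :* q :+ t :* s))
                          refl 2# k (D (j ⊕ β)) (E (j ⊕ β)) (D (j ⊖ β)) (E (j ⊖ β))

    xa-linear : ∀ k D E j → xa (λ i → k * D i + E i) j ≈ k * xa D j + xa E j
    xa-linear k D E j = trans (+-congˡ (-‿cong (+-congˡ (-‿cong (xf-linear k D E j)))))
      (solve 6 (λ t k p q f g → t :* (k :* p :+ q) :- (:- (k :* p :+ q) :- (k :* f :+ g))
                                := k :* (t :* p :- (:- p :- f)) :+ (t :* q :- (:- q :- g)))
             refl 2# k (D (j ⊕ h)) (E (j ⊕ h)) (xf D j) (xf E j))

    xb-linear : ∀ k D E j → xb (λ i → k * D i + E i) j ≈ k * xb D j + xb E j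
    xb-linear k D E j = solve 4 (λ t k p q → :- (t :* (k :* p :+ q)) := k :* (:- (t :* p)) :+ :- (t :* q))
                          refl 2# k (D j) (E j)

    L-linear : ∀ k D E j → L (λ i → k * D i + E i) j ≈ k * L D j + L E j
    L-linear k D E j =
      trans (+-cong (+-cong (xa-linear k D E (j ⊕ α)) (xa-linear k D E (j ⊖ α))) (xb-linear k D E j))
        (solve 7 (λ k a₁ b₁ a₂ b₂ d₁ d₂ → (k :* a₁ :+ b₁) :+ (k :* a₂ :+ b₂) :+ (k :* d₁ :+ d₂)
                                          := k :* (a₁ :+ a₂ :+ d₁) :+ (b₁ :+ b₂ :+ d₂))
               refl k (xa D (j ⊕ α)) (xa E (j ⊕ α)) (xa D (j ⊖ α)) (xa E (j ⊖ α)) (xb D j) (xb E j))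

    L-zero : ∀ j → L (λ _ → 0#) j ≈ 0#
    L-zero j = solve 1 (λ t → (t :* con (ℤ.+ 0) :- (:- con (ℤ.+ 0) :- (t :* con (ℤ.+ 0) :+ t :* con (ℤ.+ 0))))
                              :+ (t :* con (ℤ.+ 0) :- (:- con (ℤ.+ 0) :- (t :* con (ℤ.+ 0) :+ t :* con (ℤ.+ 0))))
                              :+ :- (t :* con (ℤ.+ 0)) := con (ℤ.+ 0)) refl 2#

  open Linearity public using (L-linear)

  module Homogeneity (t : Carrier) {D E : Fin n → Carrier} (D≈tE : ∀ j → D j ≈ t * E j) where
    open Solver

    xf-* : ∀ j → xf D j ≈ t * xf E j
    xf-* j = trans (+-cong (*-congˡ (D≈tE (j ⊕ β))) (*-congˡ (D≈tE (j ⊖ β))))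
      (solve 4 (λ t p q r → p :* (t :* q) :+ p :* (t :* r) := t :* (p :* q :+ p :* r)) refl t 2# (E (j ⊕ β)) (E (j ⊖ β)))

    xc-* : ∀ j → xc D j ≈ t * xc E j
    xc-* j = trans (+-cong (-‿cong (D≈tE (j ⊕ h))) (-‿cong (xf-* j)))
      (solve 3 (λ t p q → :- (t :* p) :- t :* q := t :* (:- p :- q)) refl t (E (j ⊕ h)) (xf E j))

    xa-* : ∀ j → xa D j ≈ t * xa E j
    xa-* j = trans (+-cong (*-congˡ (D≈tE (j ⊕ h))) (-‿cong (xc-* j)))
      (solve 4 (λ t c p q → c :* (t :* p) :- t :* q := t :* (c :* p :- q)) refl t 2# (E (j ⊕ h)) (xc E j))

    xb-* : ∀ j → xb D j ≈ t * xb E j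
    xb-* j = trans (-‿cong (*-congˡ (D≈tE j)))
      (solve 3 (λ t c p → :- (c :* (t :* p)) := t :* (:- (c :* p))) refl t 2# (E j))

  L-lincomb : ∀ {N} (k : Fin N → Carrier) (G : Fin N → Fin n → Carrier) j →
              L (λ i → sum (λ r → k r * G r i)) j ≈ sum (λ r → k r * L (G r) j)
  L-lincomb {zero}  k G j = Linearity.L-zero j
  L-lincomb {suc N} k G j =
    trans (L-linear (k Fin.zero) (G Fin.zero) (λ i → sum (λ r → k (Fin.suc r) * G (Fin.suc r) i)) j)
          (+-congˡ (L-lincomb (λ r → k (Fin.suc r)) (λ r → G (Fin.suc r)) j))

  L-shift : ∀ D s j → L (λ i → D (i ⊕ s)) j ≈ L D (j ⊕ s)
  L-shift D s j = +-congʳ (+-cong (trans (xa-shift (j ⊕ α)) (≡⇒≈ (≡.cong (xa D) (⊕-comm j α s))))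
                                  (trans (xa-shift (j ⊖ α)) (≡⇒≈ (≡.cong (xa D) (⊕-comm j (n ℕ.∸ α) s)))))
    where
    Ds : Fin n → Carrier
    Ds i = D (i ⊕ s)
    commute : ∀ i a → Ds (i ⊕ a) ≈ D (i ⊕ s ⊕ a)
    commute i a = ≡⇒≈ (≡.cong D (⊕-comm i a s))
    xa-shift : ∀ i → xa Ds i ≈ xa D (i ⊕ s)
    xa-shift i = +-cong (*-congˡ (commute i h))
                        (-‿cong (+-cong (-‿cong (commute i h))
                                        (-‿cong (+-cong (*-congˡ (commute i β)) (*-congˡ (commute i (n ℕ.∸ β)))))))

  module FourierSymbol {z : Carrier} (zⁿ≈1 : pow R z n ≈ 1#) (h≤n : h ℕ.≤ n) (α≤n : α ℕ.≤ n) (β≤n : β ℕ.≤ n) where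
    open DiscreteFourier R m z zⁿ≈1
    fourier-xf : ∀ D → fourier (xf D) ≈ symbolF z * fourier D
    fourier-xf D = begin
      fourier (xf D)
        ≈⟨ fourier-+ (λ j → 2# * D (j ⊕ β)) (λ j → 2# * D (j ⊖ β)) ⟩
      fourier (λ j → 2# * D (j ⊕ β)) + fourier (λ j → 2# * D (j ⊖ β))
        ≈⟨ +-cong (fourier-* 2# (λ j → D (j ⊕ β))) (fourier-* 2# (λ j → D (j ⊖ β))) ⟩
      2# * fourier (λ j → D (j ⊕ β)) + 2# * fourier (λ j → D (j ⊖ β))
        ≈⟨ +-cong (*-congˡ (fourier-shift β≤n D)) (*-congˡ (fourier-shift (ℕP.m∸n≤m n β) D)) ⟩
      2# * (pow R z β * fourier D) + 2# * (pow R z (n ℕ.∸ β) * fourier D)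
        ≈⟨ xf-factor _ _ _ ⟩
      symbolF z * fourier D
        ∎

    fourier-xc : ∀ D → fourier (xc D) ≈ symbolC z * fourier D
    fourier-xc D = begin
      fourier (xc D)
        ≈⟨ fourier-+ (λ j → - D (j ⊕ h)) (λ j → - xf D j) ⟩
      fourier (λ j → - D (j ⊕ h)) + fourier (λ j → - xf D j)
        ≈⟨ +-cong (fourier-neg (λ j → D (j ⊕ h))) (fourier-neg (xf D)) ⟩
      - fourier (λ j → D (j ⊕ h)) - fourier (xf D)
        ≈⟨ +-cong (-‿cong (fourier-shift h≤n D)) (-‿cong (fourier-xf D)) ⟩
      - (pow R z h * fourier D) - symbolF z * fourier D
        ≈⟨ xc-factor _ _ _ ⟩
      symbolC z * fourier D
        ∎

    fourier-xa : ∀ D → fourier (xa D) ≈ symbolA z * fourier D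
    fourier-xa D = begin
      fourier (xa D)
        ≈⟨ fourier-+ (λ j → 2# * D (j ⊕ h)) (λ j → - xc D j) ⟩
      fourier (λ j → 2# * D (j ⊕ h)) + fourier (λ j → - xc D j)
        ≈⟨ +-cong (fourier-* 2# (λ j → D (j ⊕ h))) (fourier-neg (xc D)) ⟩
      2# * fourier (λ j → D (j ⊕ h)) - fourier (xc D)
        ≈⟨ +-cong (*-congˡ (fourier-shift h≤n D)) (-‿cong (fourier-xc D)) ⟩
      2# * (pow R z h * fourier D) - symbolC z * fourier D
        ≈⟨ xa-factor _ _ _ ⟩
      symbolA z * fourier D
        ∎

    fourier-L : ∀ D → fourier (L D) ≈ symbol z * fourier D
    fourier-L D = begin
      fourier (L D)
        ≈⟨ fourier-+ (λ j → xa D (j ⊕ α) + xa D (j ⊖ α)) (xb D) ⟩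
      fourier (λ j → xa D (j ⊕ α) + xa D (j ⊖ α)) + fourier (xb D)
        ≈⟨ +-cong (fourier-+ (λ j → xa D (j ⊕ α)) (λ j → xa D (j ⊖ α))) (fourier-neg (λ j → 2# * D j)) ⟩
      fourier (λ j → xa D (j ⊕ α)) + fourier (λ j → xa D (j ⊖ α)) - fourier (λ j → 2# * D j)
        ≈⟨ +-cong (+-cong (fourier-shift α≤n (xa D)) (fourier-shift (ℕP.m∸n≤m n α) (xa D))) (-‿cong (fourier-* 2# D)) ⟩
      pow R z α * fourier (xa D) + pow R z (n ℕ.∸ α) * fourier (xa D) - 2# * fourier D
        ≈⟨ +-congʳ (+-cong (*-congˡ (fourier-xa D)) (*-congˡ (fourier-xa D))) ⟩
      pow R z α * (symbolA z * fourier D) + pow R z (n ℕ.∸ α) * (symbolA z * fourier D) - 2# * fourier D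
        ≈⟨ L-factor _ _ _ _ ⟩
      symbol z * fourier D
        ∎

  module _ {z : Carrier} (zⁿ≈1 : pow R z n ≈ 1#) (α≤n : α ℕ.≤ n) (β≤n : β ℕ.≤ n) where
    private
      A A′ B B′ H : Carrier
      A  = pow R z α
      A′ = pow R z (n ℕ.∸ α)
      B  = pow R z β
      B′ = pow R z (n ℕ.∸ β)
      H  = pow R z h

      inverse-pow : ∀ {a} → a ℕ.≤ n → pow R z a * pow R z (n ℕ.∸ a) ≈ 1#
      inverse-pow {a} a≤n =
        trans (sym (pow-+ z a (n ℕ.∸ a))) (trans (≡⇒≈ (≡.cong (pow R z) (ℕP.m+[n∸m]≡n a≤n))) zⁿ≈1)

      -- The solver cannot use A * A′ ≈ 1# and B * B′ ≈ 1#, so these products are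
      -- abstracted as u and v and replaced by 1# afterwards.
      E : Carrier → Carrier → Carrier
      E u v = (natK R 3 * (A * A * B * H) + 2# * (A * A * B * B) - 2# * (A * B))
              + u * (natK R 3 * (B * H) + 2# * (B * B)) + v * (2# * (A * A)) + (u * v) * 2#

      AB*symbol≈E : (A * B) * symbol z ≈ E (A * A′) (B * B′)
      AB*symbol≈E = solve 5 (λ A A′ B B′ H →
          (A :* B) :* (A :* (con (ℤ.+ 2) :* H :- (:- H :- (con (ℤ.+ 2) :* B :+ con (ℤ.+ 2) :* B′)))
                       :+ A′ :* (con (ℤ.+ 2) :* H :- (:- H :- (con (ℤ.+ 2) :* B :+ con (ℤ.+ 2) :* B′)))
                       :- con (ℤ.+ 2))
          := (con (ℤ.+ 3) :* (A :* A :* B :* H) :+ con (ℤ.+ 2) :* (A :* A :* B :* B) :- con (ℤ.+ 2) :* (A :* B))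
             :+ (A :* A′) :* (con (ℤ.+ 3) :* (B :* H) :+ con (ℤ.+ 2) :* (B :* B))
             :+ (B :* B′) :* (con (ℤ.+ 2) :* (A :* A)) :+ ((A :* A′) :* (B :* B′)) :* con (ℤ.+ 2))
        refl A A′ B B′ H
        where open Solver

      E≈polyG7 : E 1# 1# ≈ polyG7 R h α β z
      E≈polyG7 = begin
        E 1# 1#
          ≈⟨ solve 3 (λ A B H →
               (con (ℤ.+ 3) :* (A :* A :* B :* H) :+ con (ℤ.+ 2) :* (A :* A :* B :* B) :- con (ℤ.+ 2) :* (A :* B))
               :+ con (ℤ.+ 1) :* (con (ℤ.+ 3) :* (B :* H) :+ con (ℤ.+ 2) :* (B :* B))
               :+ con (ℤ.+ 1) :* (con (ℤ.+ 2) :* (A :* A)) :+ (con (ℤ.+ 1) :* con (ℤ.+ 1)) :* con (ℤ.+ 2)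
               := con (ℤ.+ 3) :* (A :* A :* B :* H) :+ con (ℤ.+ 3) :* (B :* H) :+ con (ℤ.+ 2) :* (A :* A :* (B :* B))
                  :+ con (ℤ.+ 2) :* (A :* A) :- con (ℤ.+ 2) :* (A :* B) :+ con (ℤ.+ 2) :* (B :* B) :+ con (ℤ.+ 2))
               refl A B H ⟩
        natK R 3 * (A * A * B * H) + natK R 3 * (B * H) + 2# * (A * A * (B * B)) + 2# * (A * A)
          - 2# * (A * B) + 2# * (B * B) + 2#
          ≈⟨ +-congʳ (+-cong (+-cong (+-cong (+-cong (+-cong (*-congˡ p₁) (*-congˡ p₂)) (*-congˡ p₃)) (*-congˡ p₄))
                                     (-‿cong (*-congˡ p₅)))
                             (*-congˡ p₆)) ⟨
        polyG7 R h α β z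
          ∎
        where
        open Solver
        pow-2* : ∀ a → pow R z (2 ℕ.* a) ≈ pow R z a * pow R z a
        pow-2* a = trans (pow-+ z a (a ℕ.+ 0)) (*-congˡ (≡⇒≈ (≡.cong (pow R z) (ℕP.+-identityʳ a))))
        p₁ : pow R z (2 ℕ.* α ℕ.+ β ℕ.+ h) ≈ A * A * B * H
        p₁ = trans (pow-+ z (2 ℕ.* α ℕ.+ β) h) (*-congʳ (trans (pow-+ z (2 ℕ.* α) β) (*-congʳ (pow-2* α))))
        p₂ : pow R z (β ℕ.+ h) ≈ B * H
        p₂ = pow-+ z β h
        p₃ : pow R z (2 ℕ.* α ℕ.+ 2 ℕ.* β) ≈ A * A * (B * B)
        p₃ = trans (pow-+ z (2 ℕ.* α) (2 ℕ.* β)) (*-cong (pow-2* α) (pow-2* β))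
        p₄ : pow R z (2 ℕ.* α) ≈ A * A
        p₄ = pow-2* α
        p₅ : pow R z (α ℕ.+ β) ≈ A * B
        p₅ = pow-+ z α β
        p₆ : pow R z (2 ℕ.* β) ≈ B * B
        p₆ = pow-2* β

    polyG7≈pow*symbol : polyG7 R h α β z ≈ pow R z (α ℕ.+ β) * symbol z
    polyG7≈pow*symbol = begin
      polyG7 R h α β z                  ≈⟨ E≈polyG7 ⟨
      E 1# 1#                           ≈⟨ E-cong (inverse-pow α≤n) (inverse-pow β≤n) ⟨
      E (A * A′) (B * B′)               ≈⟨ AB*symbol≈E ⟨
      (A * B) * symbol z                ≈⟨ *-congʳ (pow-+ z α β) ⟨
      pow R z (α ℕ.+ β) * symbol z      ∎
      where
      E-cong : ∀ {u u′ v v′} → u ≈ u′ → v ≈ v′ → E u v ≈ E u′ v′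
      E-cong u≈ v≈ = +-cong (+-cong (+-congˡ (*-congʳ u≈)) (*-congʳ v≈)) (*-congʳ (*-cong u≈ v≈))

    symbol≈0⇒polyG7≈0 : symbol z ≈ 0# → polyG7 R h α β z ≈ 0#
    symbol≈0⇒polyG7≈0 symbol≈0 = trans polyG7≈pow*symbol (trans (*-congˡ symbol≈0) (zeroʳ _))

    polyG7≈0⇒symbol≈0 : polyG7 R h α β z ≈ 0# → symbol z ≈ 0#
    polyG7≈0⇒symbol≈0 poly≈0 = begin
      symbol z                                            ≈⟨ *-identityˡ _ ⟨
      1# * symbol z                                       ≈⟨ *-congʳ z⁻ᵏzᵏ≈1 ⟨
      (pow R w k * pow R z k) * symbol z                  ≈⟨ *-assoc _ _ _ ⟩
      pow R w k * (pow R z k * symbol z)                  ≈⟨ *-congˡ (trans (sym polyG7≈pow*symbol) poly≈0) ⟩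
      pow R w k * 0#                                      ≈⟨ zeroʳ _ ⟩
      0#                                                  ∎
      where
      k : ℕ
      k = α ℕ.+ β
      w : Carrier
      w = pow R z m
      z⁻ᵏzᵏ≈1 : pow R w k * pow R z k ≈ 1#
      z⁻ᵏzᵏ≈1 = trans (sym (pow-distrib-* w z k)) (trans (pow-cong k (trans (*-comm w z) zⁿ≈1)) (1-pow k))

module PrimitiveRootOfUnity {c ℓ : Level} (K : CommutativeRing c ℓ) (isField : IsField K) (m : ℕ)
                            (ω : CommutativeRing.Carrier K) (ω-primitive : IsPrimitiveRoot K (suc m) ω) where
  open CommutativeRing K hiding (zero)
  open RingArithmetic K
  open FieldLemmas K isField
  open Cyclic m
  open import Relation.Binary.Definitions using (tri<; tri≈; tri>)
  open import Relation.Binary.Reasoning.Setoid setoid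

  ωⁿ≈1 : pow K ω n ≈ 1#
  ωⁿ≈1 = proj₁ ω-primitive

  private
    pow-ω-≉ : ∀ {a b} → a ℕ.< b → b ℕ.< n → ¬ (pow K ω a ≈ pow K ω b)
    pow-ω-≉ {a} {b} a<b b<n ωᵃ≈ωᵇ =
      proj₂ ω-primitive (b ℕ.∸ a) (ℕP.m<n⇒0<n∸m a<b) (ℕP.≤-<-trans (ℕP.m∸n≤m b a) b<n)
        (sym (*-cancelˡ (x*y≈1⇒x≉0 (pow-pow-root n a ωⁿ≈1)) (begin
          pow K ω a * 1#                ≈⟨ *-identityʳ _ ⟩
          pow K ω a                     ≈⟨ ωᵃ≈ωᵇ ⟩
          pow K ω b                     ≡⟨ ≡.cong (pow K ω) (ℕP.m+[n∸m]≡n (ℕP.<⇒≤ a<b)) ⟨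
          pow K ω (a ℕ.+ (b ℕ.∸ a))     ≈⟨ pow-+ ω a (b ℕ.∸ a) ⟩
          pow K ω a * pow K ω (b ℕ.∸ a) ∎)))

  pow-ω-injective : ∀ {a b} → a ℕ.< n → b ℕ.< n → pow K ω a ≈ pow K ω b → a ≡ b
  pow-ω-injective {a} {b} a<n b<n ωᵃ≈ωᵇ with ℕP.<-cmp a b
  ... | tri< a<b _ _ = ⊥-elim (pow-ω-≉ a<b b<n ωᵃ≈ωᵇ)
  ... | tri≈ _ a≡b _ = a≡b
  ... | tri> _ _ b<a = ⊥-elim (pow-ω-≉ b<a a<n (sym ωᵃ≈ωᵇ))

  pow-ω-half : ∀ {h} → 1 ℕ.≤ h → h ℕ.+ h ≡ n → pow K ω h ≈ - 1#
  pow-ω-half {h} 1≤h h+h≡n = +-inverseˡ-unique y 1# (x*y≈0⇒y≈0 (x-1≉0 y≉1) (begin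
      (y - 1#) * (y + 1#)   ≈⟨ solve 1 (λ y → (y :- con (ℤ.+ 1)) :* (y :+ con (ℤ.+ 1)) := y :* y :- con (ℤ.+ 1)) refl y ⟩
      y * y - 1#            ≈⟨ +-congʳ y²≈1 ⟩
      1# - 1#               ≈⟨ -‿inverseʳ 1# ⟩
      0#                    ∎))
    where
    open Solver
    y : Carrier
    y = pow K ω h
    h<n : h ℕ.< n
    h<n = ≡.subst (h ℕ.<_) h+h≡n (ℕP.m<m+n h 1≤h)
    y≉1 : ¬ (y ≈ 1#)
    y≉1 = proj₂ ω-primitive h 1≤h h<n
    y²≈1 : y * y ≈ 1#
    y²≈1 = trans (sym (pow-+ ω h h)) (trans (≡⇒≈ (≡.cong (pow K ω) h+h≡n)) ωⁿ≈1)

  root : Fin n → Carrier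
  root k = pow K ω (toℕ k)

  rootⁿ≈1 : ∀ k → pow K (root k) n ≈ 1#
  rootⁿ≈1 k = pow-pow-root n (toℕ k) ωⁿ≈1

  module Fourierₖ (k : Fin n) = DiscreteFourier K m (root k) (rootⁿ≈1 k)

  private
    -- entry of the product of the Fourier matrix with its inverse
    entry : Fin n → Fin n → Fin n → Carrier
    entry j j′ k = pow K (Fourierₖ.w k) (toℕ j) * pow K (root k) (toℕ j′)

    entry≈ : ∀ j j′ k → entry j j′ k ≈ pow K (pow K ω (m ℕ.* toℕ j ℕ.+ toℕ j′)) (toℕ k)
    entry≈ j j′ k = begin
      pow K (pow K (root k) m) (toℕ j) * pow K (root k) (toℕ j′)  ≈⟨ *-congʳ (pow-* (root k) m (toℕ j)) ⟨
      pow K (root k) (m ℕ.* toℕ j) * pow K (root k) (toℕ j′)       ≈⟨ pow-+ (root k) (m ℕ.* toℕ j) (toℕ j′) ⟨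
      pow K (pow K ω (toℕ k)) e                                    ≈⟨ pow-* ω (toℕ k) e ⟨
      pow K ω (toℕ k ℕ.* e)                                        ≡⟨ ≡.cong (pow K ω) (ℕP.*-comm (toℕ k) e) ⟩
      pow K ω (e ℕ.* toℕ k)                                        ≈⟨ pow-* ω e (toℕ k) ⟩
      pow K (pow K ω e) (toℕ k)                                    ∎
      where
      e : ℕ
      e = m ℕ.* toℕ j ℕ.+ toℕ j′

    ωⁿʲ≈1 : ∀ j → pow K ω (n ℕ.* j) ≈ 1#
    ωⁿʲ≈1 j = trans (pow-* ω n j) (trans (pow-cong j ωⁿ≈1) (1-pow j))

    sum-entry-diagonal : ∀ j → sum (entry j j) ≈ natK K n
    sum-entry-diagonal j = begin
      sum (entry j j)        ≈⟨ sum-cong-≋ (λ k → trans (entry≈ j j k) (trans (pow-cong (toℕ k) r≈1) (1-pow (toℕ k)))) ⟩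
      sum {n} (λ _ → 1#)     ≈⟨ sum-ones n ⟩
      natK K n               ∎
      where
      r≈1 : pow K ω (m ℕ.* toℕ j ℕ.+ toℕ j) ≈ 1#
      r≈1 = trans (≡⇒≈ (≡.cong (pow K ω) (ℕP.+-comm (m ℕ.* toℕ j) (toℕ j)))) (ωⁿʲ≈1 (toℕ j))

    sum-entry-off-diagonal : ∀ j j′ → j ≢ j′ → sum (entry j j′) ≈ 0#
    sum-entry-off-diagonal j j′ j≢j′ =
      trans (sum-cong-≋ (entry≈ j j′)) (sum-powers-of-root n r≉1 (pow-pow-root n e ωⁿ≈1))
      where
      e : ℕ
      e = m ℕ.* toℕ j ℕ.+ toℕ j′
      rωʲ≈ωʲ′ : pow K ω e * pow K ω (toℕ j) ≈ pow K ω (toℕ j′)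
      rωʲ≈ωʲ′ = begin
        pow K ω e * pow K ω (toℕ j)           ≈⟨ pow-+ ω e (toℕ j) ⟨
        pow K ω (e ℕ.+ toℕ j)                 ≡⟨ ≡.cong (pow K ω) (ℕ-identity (toℕ j) (toℕ j′)) ⟩
        pow K ω (toℕ j′ ℕ.+ n ℕ.* toℕ j)      ≈⟨ pow-+ ω (toℕ j′) (n ℕ.* toℕ j) ⟩
        pow K ω (toℕ j′) * pow K ω (n ℕ.* toℕ j) ≈⟨ *-congˡ (ωⁿʲ≈1 (toℕ j)) ⟩
        pow K ω (toℕ j′) * 1#                 ≈⟨ *-identityʳ _ ⟩
        pow K ω (toℕ j′)                      ∎
        where
        ℕ-identity : ∀ a b → m ℕ.* a ℕ.+ b ℕ.+ a ≡ b ℕ.+ n ℕ.* a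
        ℕ-identity a b = solve 3 (λ m a b → m :* a :+ b :+ a := b :+ (con 1 :+ m) :* a) ≡.refl m a b
          where
          open import Data.Nat.Solver using (module +-*-Solver)
          open +-*-Solver
      r≉1 : ¬ (pow K ω e ≈ 1#)
      r≉1 r≈1 = j≢j′ (FinP.toℕ-injective (pow-ω-injective (FinP.toℕ<n j) (FinP.toℕ<n j′)
                  (trans (sym (*-identityˡ _)) (trans (*-congʳ (sym r≈1)) rωʲ≈ωʲ′))))

  fourier-inversion : ∀ F j′ → sum (λ k → Fourierₖ.fourier k F * pow K (root k) (toℕ j′)) ≈ natK K n * F j′
  fourier-inversion F j′ = begin
    sum (λ k → sum (λ j → F j * W k j) * Z k)     ≈⟨ sum-cong-≋ (λ k → *-distribʳ-sum (Z k) (λ j → F j * W k j)) ⟩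
    sum (λ k → sum (λ j → (F j * W k j) * Z k))   ≈⟨ ∑-comm (λ k j → (F j * W k j) * Z k) ⟩
    sum (λ j → sum (λ k → (F j * W k j) * Z k))   ≈⟨ sum-cong-≋ (λ j → trans (sum-cong-≋ (λ k → *-assoc (F j) (W k j) (Z k)))
                                                                            (sym (*-distribˡ-sum (F j) (entry j j′)))) ⟩
    sum (λ j → F j * sum (entry j j′))            ≈⟨ sum-δ (λ j → F j * sum (entry j j′)) j′
                                                         (λ j j≢j′ → trans (*-congˡ (sum-entry-off-diagonal j j′ j≢j′)) (zeroʳ _)) ⟩
    F j′ * sum (entry j′ j′)                      ≈⟨ *-congˡ (sum-entry-diagonal j′) ⟩
    F j′ * natK K n                               ≈⟨ *-comm _ _ ⟩
    natK K n * F j′                               ∎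
    where
    W : Fin n → Fin n → Carrier
    W k j = pow K (Fourierₖ.w k) (toℕ j)
    Z : Fin n → Carrier
    Z k = pow K (root k) (toℕ j′)

==-refl : ∀ {n} (i : Fin n) → (i == i) ≡ true
==-refl i with i FinP.≟ i
... | yes _   = ≡.refl
... | no  i≢i = ⊥-elim (i≢i ≡.refl)

==-≢ : ∀ {n} {i j : Fin n} → i ≢ j → (i == j) ≡ false
==-≢ {i = i} {j} i≢j with i FinP.≟ j
... | yes i≡j = ⊥-elim (i≢j i≡j)
... | no  _   = ≡.refl

module IndicatorSums where
  open RingArithmetic ℚ-ring using (sum; sum-zero; sum-δ; sum-δ₂)

  sumFin≡sum : ∀ N (f : Fin N → ℚ) → sumFin N f ≡ sum f
  sumFin≡sum zero    f = ≡.refl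
  sumFin≡sum (suc N) f = ≡.cong (f Fin.zero ℚ.+_) (sumFin≡sum N (λ i → f (Fin.suc i)))

  private
    off : ∀ {N} (c : Fin N → Bool) (y : Fin N → ℚ) j → c j ≡ false → boolℚ (c j) ℚ.* y j ≡ 0ℚ
    off c y j cj≡false = ≡.trans (≡.cong (λ b → boolℚ b ℚ.* y j) cj≡false) (ℚP.*-zeroˡ (y j))

    on : ∀ {N} (c : Fin N → Bool) (y : Fin N → ℚ) j → c j ≡ true → boolℚ (c j) ℚ.* y j ≡ y j
    on c y j cj≡true = ≡.trans (≡.cong (λ b → boolℚ b ℚ.* y j) cj≡true) (ℚP.*-identityˡ (y j))

  sumFin-indicator₀ : ∀ N (y : Fin N → ℚ) → sumFin N (λ j → boolℚ false ℚ.* y j) ≡ 0ℚ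
  sumFin-indicator₀ N y = ≡.trans (sumFin≡sum N _) (sum-zero (λ j → boolℚ false ℚ.* y j) (λ j → ℚP.*-zeroˡ (y j)))

  sumFin-indicator₁ : ∀ {N} (c : Fin N → Bool) (y : Fin N → ℚ) {t} → c t ≡ true →
                      (∀ j → j ≢ t → c j ≡ false) → sumFin N (λ j → boolℚ (c j) ℚ.* y j) ≡ y t
  sumFin-indicator₁ {N} c y {t} ct c-off = begin
    sumFin N (λ j → boolℚ (c j) ℚ.* y j)   ≡⟨ sumFin≡sum N _ ⟩
    sum (λ j → boolℚ (c j) ℚ.* y j)        ≡⟨ sum-δ _ t (λ j j≢t → off c y j (c-off j j≢t)) ⟩
    boolℚ (c t) ℚ.* y t                    ≡⟨ on c y t ct ⟩
    y t                                    ∎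
    where open ≡.≡-Reasoning

  sumFin-indicator₂ : ∀ {N} (c : Fin N → Bool) (y : Fin N → ℚ) {t₁ t₂} → t₁ ≢ t₂ → c t₁ ≡ true → c t₂ ≡ true →
                      (∀ j → j ≢ t₁ → j ≢ t₂ → c j ≡ false) →
                      sumFin N (λ j → boolℚ (c j) ℚ.* y j) ≡ y t₁ ℚ.+ y t₂
  sumFin-indicator₂ {N} c y {t₁} {t₂} t₁≢t₂ ct₁ ct₂ c-off = begin
    sumFin N (λ j → boolℚ (c j) ℚ.* y j)                    ≡⟨ sumFin≡sum N _ ⟩
    sum (λ j → boolℚ (c j) ℚ.* y j)                         ≡⟨ sum-δ₂ _ t₁≢t₂ (λ j j≢t₁ j≢t₂ → off c y j (c-off j j≢t₁ j≢t₂)) ⟩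
    boolℚ (c t₁) ℚ.* y t₁ ℚ.+ boolℚ (c t₂) ℚ.* y t₂         ≡⟨ ≡.cong₂ ℚ._+_ (on c y t₁ ct₁) (on c y t₂ ct₂) ⟩
    y t₁ ℚ.+ y t₂                                           ∎
    where open ≡.≡-Reasoning

module AdjacencyRows (m α β : ℕ) (h+h≡n : suc m ℕ./ 2 ℕ.+ suc m ℕ./ 2 ≡ suc m)
                     (0<α : 0 ℕ.< α) (2α<n : α ℕ.+ α ℕ.< suc m) (0<β : 0 ℕ.< β) (2β<n : β ℕ.+ β ℕ.< suc m) where
  open IndicatorSums
  open import Data.Bool using (_∨_)
  open import Data.Bool.Properties using (∨-zeroʳ)
  open import Function using (_∘_)
  open import Data.Rational.Solver using (module +-*-Solver)

  h : ℕ
  h = suc m ℕ./ 2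

  open ReducedOperator ℚ-ring m h α β public

  Adj : Vertex n → Vertex n → ℚ
  Adj = adjMatrixG7 n α β

  row : (Vertex n → ℚ) → Vertex n → ℚ
  row x u = sumVertex n (λ v → Adj u v ℚ.* x v)

  ⊕h⊕h : ∀ j → j ⊕ h ⊕ h ≡ j
  ⊕h⊕h j = ≡.trans (⊕-+ j h h) (≡.trans (≡.cong (j ⊕_) h+h≡n) (⊕-n j))

  private
    sum-self : ∀ i (y : Fin n → ℚ) → sumFin n (λ j → boolℚ ((i == j) ∨ false) ℚ.* y j) ≡ y i
    sum-self i y = sumFin-indicator₁ _ y (≡.cong (_∨ false) (==-refl i))
                     (λ j j≢i → ≡.cong (_∨ false) (==-≢ (j≢i ∘ ≡.sym)))

    sum-self′ : ∀ i (y : Fin n → ℚ) → sumFin n (λ j → boolℚ (j == i) ℚ.* y j) ≡ y i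
    sum-self′ i y = sumFin-indicator₁ _ y (==-refl i) (λ j j≢i → ==-≢ j≢i)

    sum-antipode : ∀ i (y : Fin n → ℚ) → sumFin n (λ j → boolℚ ((j == (i ⊕ h)) ∨ (i == (j ⊕ h))) ℚ.* y j) ≡ y (i ⊕ h)
    sum-antipode i y = sumFin-indicator₁ _ y (≡.cong (_∨ (i == (i ⊕ h ⊕ h))) (==-refl (i ⊕ h)))
      (λ j j≢i⊕h → ≡.trans (≡.cong (_∨ (i == (j ⊕ h))) (==-≢ j≢i⊕h))
                           (==-≢ (λ i≡j⊕h → j≢i⊕h (≡.trans (≡.sym (⊕h⊕h j)) (≡.cong (_⊕ h) (≡.sym i≡j⊕h))))))

    sum-pair : ∀ {a} → 0 ℕ.< a → a ℕ.+ a ℕ.< n → ∀ i (y : Fin n → ℚ) →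
               sumFin n (λ j → boolℚ ((j == (i ⊕ a)) ∨ (i == (j ⊕ a))) ℚ.* y j) ≡ y (i ⊕ a) ℚ.+ y (i ⊖ a)
    sum-pair {a} 0<a 2a<n i y = sumFin-indicator₂ _ y (⊕≢⊖ 0<a 2a<n i)
      (≡.cong (_∨ (i == (i ⊕ a ⊕ a))) (==-refl (i ⊕ a)))
      (≡.trans (≡.cong (((i ⊖ a) == (i ⊕ a)) ∨_) (≡.trans (≡.cong (i ==_) (⊖-⊕ a≤n i)) (==-refl i))) (∨-zeroʳ _))
      (λ j j≢i⊕a j≢i⊖a → ≡.trans (≡.cong (_∨ (i == (j ⊕ a))) (==-≢ j≢i⊕a))
                                 (==-≢ (λ i≡j⊕a → j≢i⊖a (≡.trans (≡.sym (⊕-⊖ a≤n j)) (≡.cong (_⊖ a) (≡.sym i≡j⊕a))))))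
      where
      a≤n : a ℕ.≤ n
      a≤n = ℕP.≤-trans (ℕP.m≤m+n a a) (ℕP.<⇒≤ 2a<n)

    sum-none : ∀ (y : Fin n → ℚ) → sumFin n (λ j → boolℚ false ℚ.* y j) ≡ 0ℚ
    sum-none = sumFin-indicator₀ n

    sumLabel≡ : ∀ (s : Label → ℚ) {pa pb pc pd pe pf pg} →
                s Label.a ≡ pa → s Label.b ≡ pb → s Label.c ≡ pc → s Label.d ≡ pd →
                s Label.e ≡ pe → s Label.f ≡ pf → s Label.g ≡ pg →
                sumLabel s ≡ pa ℚ.+ (pb ℚ.+ (pc ℚ.+ (pd ℚ.+ (pe ℚ.+ (pf ℚ.+ pg)))))
    sumLabel≡ s ≡.refl ≡.refl ≡.refl ≡.refl ≡.refl ≡.refl ≡.refl = ≡.refl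

    open +-*-Solver

  module _ (x : Vertex n → ℚ) where
    private
      _at_ : Label → Fin n → ℚ
      l at j = x (l , j)

      part : Vertex n → Label → ℚ
      part u l = sumFin n (λ j → Adj u (l , j) ℚ.* x (l , j))

      none : ∀ l → sumFin n (λ j → boolℚ false ℚ.* x (l , j)) ≡ 0ℚ
      none l = sum-none (l at_)

    row-a : ∀ i → row x (Label.a , i) ≡ x (Label.a , i ⊕ α) ℚ.+ x (Label.a , i ⊖ α) ℚ.+ x (Label.b , i)
    row-a i = ≡.trans
      (sumLabel≡ (part (Label.a , i)) (sum-pair 0<α 2α<n i (Label.a at_)) (sum-self i (Label.b at_))
                 (none Label.c) (none Label.d) (none Label.e) (none Label.f) (none Label.g))
      (solve 3 (λ p q r → (p :+ q) :+ (r :+ (con 0ℚ :+ (con 0ℚ :+ (con 0ℚ :+ (con 0ℚ :+ con 0ℚ))))) := p :+ q :+ r) ≡.refl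
             (x (Label.a , i ⊕ α)) (x (Label.a , i ⊖ α)) (x (Label.b , i)))

    row-b : ∀ i → row x (Label.b , i) ≡ x (Label.a , i) ℚ.+ x (Label.b , i ⊕ h) ℚ.+ x (Label.c , i)
    row-b i = ≡.trans
      (sumLabel≡ (part (Label.b , i)) (sum-self′ i (Label.a at_)) (sum-antipode i (Label.b at_)) (sum-self i (Label.c at_))
                 (none Label.d) (none Label.e) (none Label.f) (none Label.g))
      (solve 3 (λ p q r → p :+ (q :+ (r :+ (con 0ℚ :+ (con 0ℚ :+ (con 0ℚ :+ con 0ℚ))))) := p :+ q :+ r) ≡.refl
             (x (Label.a , i)) (x (Label.b , i ⊕ h)) (x (Label.c , i)))

    row-c : ∀ i → row x (Label.c , i) ≡ x (Label.b , i) ℚ.+ x (Label.d , i) ℚ.+ x (Label.e , i)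
    row-c i = ≡.trans
      (sumLabel≡ (part (Label.c , i)) (none Label.a) (sum-self′ i (Label.b at_)) (none Label.c)
                 (sum-self i (Label.d at_)) (sum-self i (Label.e at_)) (none Label.f) (none Label.g))
      (solve 3 (λ p q r → con 0ℚ :+ (p :+ (con 0ℚ :+ (q :+ (r :+ (con 0ℚ :+ con 0ℚ))))) := p :+ q :+ r) ≡.refl
             (x (Label.b , i)) (x (Label.d , i)) (x (Label.e , i)))

    row-d : ∀ i → row x (Label.d , i) ≡ x (Label.c , i) ℚ.+ x (Label.d , i ⊕ h) ℚ.+ x (Label.f , i)
    row-d i = ≡.trans
      (sumLabel≡ (part (Label.d , i)) (none Label.a) (none Label.b) (sum-self′ i (Label.c at_))
                 (sum-antipode i (Label.d at_)) (none Label.e) (sum-self i (Label.f at_)) (none Label.g))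
      (solve 3 (λ p q r → con 0ℚ :+ (con 0ℚ :+ (p :+ (q :+ (con 0ℚ :+ (r :+ con 0ℚ))))) := p :+ q :+ r) ≡.refl
             (x (Label.c , i)) (x (Label.d , i ⊕ h)) (x (Label.f , i)))

    row-e : ∀ i → row x (Label.e , i) ≡ x (Label.c , i) ℚ.+ x (Label.e , i ⊕ h) ℚ.+ x (Label.f , i)
    row-e i = ≡.trans
      (sumLabel≡ (part (Label.e , i)) (none Label.a) (none Label.b) (sum-self′ i (Label.c at_))
                 (none Label.d) (sum-antipode i (Label.e at_)) (sum-self i (Label.f at_)) (none Label.g))
      (solve 3 (λ p q r → con 0ℚ :+ (con 0ℚ :+ (p :+ (con 0ℚ :+ (q :+ (r :+ con 0ℚ))))) := p :+ q :+ r) ≡.refl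
             (x (Label.c , i)) (x (Label.e , i ⊕ h)) (x (Label.f , i)))

    row-f : ∀ i → row x (Label.f , i) ≡ x (Label.d , i) ℚ.+ x (Label.e , i) ℚ.+ x (Label.g , i)
    row-f i = ≡.trans
      (sumLabel≡ (part (Label.f , i)) (none Label.a) (none Label.b) (none Label.c)
                 (sum-self′ i (Label.d at_)) (sum-self′ i (Label.e at_)) (none Label.f) (sum-self i (Label.g at_)))
      (solve 3 (λ p q r → con 0ℚ :+ (con 0ℚ :+ (con 0ℚ :+ (p :+ (q :+ (con 0ℚ :+ r))))) := p :+ q :+ r) ≡.refl
             (x (Label.d , i)) (x (Label.e , i)) (x (Label.g , i)))

    row-g : ∀ i → row x (Label.g , i) ≡ x (Label.f , i) ℚ.+ x (Label.g , i ⊕ β) ℚ.+ x (Label.g , i ⊖ β)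
    row-g i = ≡.trans
      (sumLabel≡ (part (Label.g , i)) (none Label.a) (none Label.b) (none Label.c)
                 (none Label.d) (none Label.e) (sum-self′ i (Label.f at_)) (sum-pair 0<β 2β<n i (Label.g at_)))
      (solve 3 (λ p q r → con 0ℚ :+ (con 0ℚ :+ (con 0ℚ :+ (con 0ℚ :+ (con 0ℚ :+ (p :+ (q :+ r)))))) := p :+ q :+ r) ≡.refl
             (x (Label.f , i)) (x (Label.g , i ⊕ β)) (x (Label.g , i ⊖ β)))

module KernelReduction (m α β : ℕ) (h+h≡n : suc m ℕ./ 2 ℕ.+ suc m ℕ./ 2 ≡ suc m)
                       (0<α : 0 ℕ.< α) (2α<n : α ℕ.+ α ℕ.< suc m) (0<β : 0 ℕ.< β) (2β<n : β ℕ.+ β ℕ.< suc m) where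
  open AdjacencyRows m α β h+h≡n 0<α 2α<n 0<β 2β<n public
  open CommutativeRing ℚ-ring using (_+_; _-_; -_)
  open RingArithmetic ℚ-ring using (module Solver)
  open ≡.≡-Reasoning

  extend : (Fin n → ℚ) → Vertex n → ℚ
  extend D (Label.a , j) = xa D j
  extend D (Label.b , j) = xb D j
  extend D (Label.c , j) = xc D j
  extend D (Label.d , j) = D j
  extend D (Label.e , j) = D j
  extend D (Label.f , j) = xf D j
  extend D (Label.g , j) = xb D j

  extend-kernel : ∀ D → (∀ i → L D i ≡ 0ℚ) → InKernel Adj (extend D)
  extend-kernel D LD≡0 (Label.a , i) = ≡.trans (row-a (extend D) i) (LD≡0 i)
  extend-kernel D LD≡0 (Label.b , i) = ≡.trans (row-b (extend D) i)
    (solve 2 (λ p q → con (ℤ.+ 2) :* p :- q :+ :- (con (ℤ.+ 2) :* p) :+ q := con (ℤ.+ 0)) ≡.refl (D (i ⊕ h)) (xc D i))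
    where open Solver
  extend-kernel D LD≡0 (Label.c , i) = ≡.trans (row-c (extend D) i)
    (solve 1 (λ p → :- (con (ℤ.+ 2) :* p) :+ p :+ p := con (ℤ.+ 0)) ≡.refl (D i))
    where open Solver
  extend-kernel D LD≡0 (Label.d , i) = ≡.trans (row-d (extend D) i)
    (solve 2 (λ p q → :- p :- q :+ p :+ q := con (ℤ.+ 0)) ≡.refl (D (i ⊕ h)) (xf D i))
    where open Solver
  extend-kernel D LD≡0 (Label.e , i) = ≡.trans (row-e (extend D) i)
    (solve 2 (λ p q → :- p :- q :+ p :+ q := con (ℤ.+ 0)) ≡.refl (D (i ⊕ h)) (xf D i))
    where open Solver
  extend-kernel D LD≡0 (Label.f , i) = ≡.trans (row-f (extend D) i)
    (solve 1 (λ p → p :+ p :+ :- (con (ℤ.+ 2) :* p) := con (ℤ.+ 0)) ≡.refl (D i))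
    where open Solver
  extend-kernel D LD≡0 (Label.g , i) = ≡.trans (row-g (extend D) i)
    (solve 2 (λ p q → con (ℤ.+ 2) :* p :+ con (ℤ.+ 2) :* q :+ :- (con (ℤ.+ 2) :* p) :+ :- (con (ℤ.+ 2) :* q) := con (ℤ.+ 0))
           ≡.refl (D (i ⊕ β)) (D (i ⊖ β)))
    where open Solver

  extend-* : ∀ t {D E} → (∀ j → D j ≡ t ℚ.* E j) → ∀ v → extend D v ≡ t ℚ.* extend E v
  extend-* t D≡tE (Label.a , j) = xa-* j where open Homogeneity t D≡tE
  extend-* t D≡tE (Label.b , j) = xb-* j where open Homogeneity t D≡tE
  extend-* t D≡tE (Label.c , j) = xc-* j where open Homogeneity t D≡tE
  extend-* t D≡tE (Label.d , j) = D≡tE j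
  extend-* t D≡tE (Label.e , j) = D≡tE j
  extend-* t D≡tE (Label.f , j) = xf-* j where open Homogeneity t D≡tE
  extend-* t D≡tE (Label.g , j) = xb-* j where open Homogeneity t D≡tE

  private
    first : ∀ p q r → p + q + r ≡ 0ℚ → p ≡ - q - r
    first p q r p+q+r≡0 = begin
      p                          ≡⟨ solve 3 (λ p q r → p := (p :+ q :+ r) :+ (:- q :- r)) ≡.refl p q r ⟩
      (p + q + r) + (- q - r)    ≡⟨ ≡.cong (_+ (- q - r)) p+q+r≡0 ⟩
      0ℚ + (- q - r)             ≡⟨ ℚP.+-identityˡ _ ⟩
      - q - r                    ∎
      where open Solver

    last : ∀ p q r → p + q + r ≡ 0ℚ → r ≡ - p - q
    last p q r p+q+r≡0 = first r p q (≡.trans (solve 3 (λ p q r → r :+ p :+ q := p :+ q :+ r) ≡.refl p q r) p+q+r≡0)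
      where open Solver

    middle : ∀ p q r → p + q + r ≡ 0ℚ → q ≡ - p - r
    middle p q r p+q+r≡0 = first q p r (≡.trans (solve 3 (λ p q r → q :+ p :+ r := p :+ q :+ r) ≡.refl p q r) p+q+r≡0)
      where open Solver

    middle-unique : ∀ p q q′ r → p + q + r ≡ 0ℚ → p + q′ + r ≡ 0ℚ → q ≡ q′
    middle-unique p q q′ r eq eq′ = ≡.trans (middle p q r eq) (≡.sym (middle p q′ r eq′))

  module Restriction (x : Vertex n → ℚ) (x∈ker : InKernel Adj x) where
    D : Fin n → ℚ
    D j = x (Label.d , j)

    private
      eq : ∀ l i → row x (l , i) ≡ 0ℚ
      eq l i = x∈ker (l , i)

      x-e : ∀ j → x (Label.e , j) ≡ D j
      x-e j = begin
        x (Label.e , j)           ≡⟨ ≡.cong (λ k → x (Label.e , k)) (⊕h⊕h j) ⟨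
        x (Label.e , j ⊕ h ⊕ h)   ≡⟨ middle-unique (x (Label.c , j ⊕ h)) (x (Label.e , j ⊕ h ⊕ h)) (D (j ⊕ h ⊕ h)) (x (Label.f , j ⊕ h)) (≡.trans (≡.sym (row-e x (j ⊕ h))) (eq Label.e (j ⊕ h)))
                                                         (≡.trans (≡.sym (row-d x (j ⊕ h))) (eq Label.d (j ⊕ h))) ⟩
        D (j ⊕ h ⊕ h)             ≡⟨ ≡.cong D (⊕h⊕h j) ⟩
        D j                       ∎

      x-b : ∀ j → x (Label.b , j) ≡ xb D j
      x-b j = begin
        x (Label.b , j)          ≡⟨ first _ (D j) (x (Label.e , j)) (≡.trans (≡.sym (row-c x j)) (eq Label.c j)) ⟩
        - D j - x (Label.e , j)  ≡⟨ ≡.cong (λ t → - D j - t) (x-e j) ⟩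
        - D j - D j              ≡⟨ solve 1 (λ p → :- p :- p := :- (con (ℤ.+ 2) :* p)) ≡.refl (D j) ⟩
        xb D j                   ∎
        where open Solver

      x-g : ∀ j → x (Label.g , j) ≡ xb D j
      x-g j = begin
        x (Label.g , j)          ≡⟨ last (D j) (x (Label.e , j)) _ (≡.trans (≡.sym (row-f x j)) (eq Label.f j)) ⟩
        - D j - x (Label.e , j)  ≡⟨ ≡.cong (λ t → - D j - t) (x-e j) ⟩
        - D j - D j              ≡⟨ solve 1 (λ p → :- p :- p := :- (con (ℤ.+ 2) :* p)) ≡.refl (D j) ⟩
        xb D j                   ∎
        where open Solver

      x-f : ∀ j → x (Label.f , j) ≡ xf D j
      x-f j = begin
        x (Label.f , j)                             ≡⟨ first _ (x (Label.g , j ⊕ β)) (x (Label.g , j ⊖ β)) (≡.trans (≡.sym (row-g x j)) (eq Label.g j)) ⟩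
        - x (Label.g , j ⊕ β) - x (Label.g , j ⊖ β) ≡⟨ ≡.cong₂ (λ s t → - s - t) (x-g (j ⊕ β)) (x-g (j ⊖ β)) ⟩
        - xb D (j ⊕ β) - xb D (j ⊖ β)               ≡⟨ solve 2 (λ p q → :- (:- (con (ℤ.+ 2) :* p)) :- :- (con (ℤ.+ 2) :* q)
                                                                       := con (ℤ.+ 2) :* p :+ con (ℤ.+ 2) :* q)
                                                                ≡.refl (D (j ⊕ β)) (D (j ⊖ β)) ⟩
        xf D j                                      ∎
        where open Solver

      x-c : ∀ j → x (Label.c , j) ≡ xc D j
      x-c j = begin
        x (Label.c , j)               ≡⟨ first _ (D (j ⊕ h)) (x (Label.f , j)) (≡.trans (≡.sym (row-d x j)) (eq Label.d j)) ⟩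
        - D (j ⊕ h) - x (Label.f , j) ≡⟨ ≡.cong (λ t → - D (j ⊕ h) - t) (x-f j) ⟩
        xc D j                        ∎

      x-a : ∀ j → x (Label.a , j) ≡ xa D j
      x-a j = begin
        x (Label.a , j)                       ≡⟨ first _ (x (Label.b , j ⊕ h)) (x (Label.c , j)) (≡.trans (≡.sym (row-b x j)) (eq Label.b j)) ⟩
        - x (Label.b , j ⊕ h) - x (Label.c , j) ≡⟨ ≡.cong₂ (λ s t → - s - t) (x-b (j ⊕ h)) (x-c j) ⟩
        - xb D (j ⊕ h) - xc D j               ≡⟨ solve 2 (λ p q → :- (:- (con (ℤ.+ 2) :* p)) :- q := con (ℤ.+ 2) :* p :- q)
                                                         ≡.refl (D (j ⊕ h)) (xc D j) ⟩
        xa D j                                ∎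
        where open Solver

    x≡extend : ∀ v → x v ≡ extend D v
    x≡extend (Label.a , j) = x-a j
    x≡extend (Label.b , j) = x-b j
    x≡extend (Label.c , j) = x-c j
    x≡extend (Label.d , j) = ≡.refl
    x≡extend (Label.e , j) = x-e j
    x≡extend (Label.f , j) = x-f j
    x≡extend (Label.g , j) = x-g j

    L-restriction : ∀ i → L D i ≡ 0ℚ
    L-restriction i = begin
      L D i                                                      ≡⟨ ≡.cong₂ _+_ (≡.cong₂ _+_ (x-a (i ⊕ α)) (x-a (i ⊖ α))) (x-b i) ⟨
      x (Label.a , i ⊕ α) + x (Label.a , i ⊖ α) + x (Label.b , i) ≡⟨ ≡.sym (row-a x i) ⟩
      row x (Label.a , i)                                        ≡⟨ eq Label.a i ⟩
      0ℚ                                                         ∎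

module NutCriterion (m α β : ℕ) (h+h≡n : suc m ℕ./ 2 ℕ.+ suc m ℕ./ 2 ≡ suc m)
                    (0<α : 0 ℕ.< α) (2α<n : α ℕ.+ α ℕ.< suc m) (0<β : 0 ℕ.< β) (2β<n : β ℕ.+ β ℕ.< suc m) where
  open KernelReduction m α β h+h≡n 0<α 2α<n 0<β 2β<n public
  open RationalNumbers
  open RingArithmetic ℚ-ring using (pow-mod; pow-+; pow-distrib-*; 1-pow; sum; sum-cong-≋; sum-ones; sum-zero; sum-δ)

  α≤n : α ℕ.≤ n
  α≤n = ℕP.≤-trans (ℕP.m≤m+n α α) (ℕP.<⇒≤ 2α<n)

  β≤n : β ℕ.≤ n
  β≤n = ℕP.≤-trans (ℕP.m≤m+n β β) (ℕP.<⇒≤ 2β<n)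

  h≤n : h ℕ.≤ n
  h≤n = ≡.subst (h ℕ.≤_) h+h≡n (ℕP.m≤m+n h h)

  1≤h : 1 ℕ.≤ h
  1≤h = ℕP.n≢0⇒n>0 (λ h≡0 → ℕP.0≢1+n (≡.trans (≡.cong (λ k → k ℕ.+ k) (≡.sym h≡0)) h+h≡n))

  φ : Fin n → ℚ
  φ j = pow ℚ-ring -1ℚ (toℕ j)

  -1ⁿ≡1 : pow ℚ-ring -1ℚ n ≡ 1ℚ
  -1ⁿ≡1 = begin
    pow ℚ-ring -1ℚ n                               ≡⟨ ≡.cong (pow ℚ-ring -1ℚ) h+h≡n ⟨
    pow ℚ-ring -1ℚ (h ℕ.+ h)                       ≡⟨ pow-+ -1ℚ h h ⟩
    pow ℚ-ring -1ℚ h ℚ.* pow ℚ-ring -1ℚ h          ≡⟨ sign*sign (pow-1-sign h) ⟩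
    1ℚ                                             ∎
    where open ≡.≡-Reasoning

  φ-eigen : ∀ j k → φ (j ⊕ k) ≡ pow ℚ-ring -1ℚ k ℚ.* φ j
  φ-eigen j k = begin
    pow ℚ-ring -1ℚ (toℕ (j ⊕ k))                       ≡⟨ ≡.cong (pow ℚ-ring -1ℚ) (toℕ-⊕ j k) ⟩
    pow ℚ-ring -1ℚ ((toℕ j ℕ.+ k) ℕ.% n)               ≡⟨ pow-mod n -1ⁿ≡1 (toℕ j ℕ.+ k) ⟩
    pow ℚ-ring -1ℚ (toℕ j ℕ.+ k)                       ≡⟨ pow-+ -1ℚ (toℕ j) k ⟩
    φ j ℚ.* pow ℚ-ring -1ℚ k                           ≡⟨ ℚP.*-comm (φ j) _ ⟩
    pow ℚ-ring -1ℚ k ℚ.* φ j                           ∎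
    where open ≡.≡-Reasoning

  φ-nonzero : ∀ j → φ j ≢ 0ℚ
  φ-nonzero j = sign-nonzero (pow-1-sign (toℕ j))

  open Eigenvector -1ℚ φ φ-eigen using (xf-eigen; xc-eigen; xa-eigen) renaming (L-eigen to L-φ-eigen)

  L-φ : symbol -1ℚ ≡ 0ℚ → ∀ j → L φ j ≡ 0ℚ
  L-φ symbol≡0 j = ≡.trans (L-φ-eigen j) (≡.trans (≡.cong (ℚ._* φ j) symbol≡0) (ℚP.*-zeroˡ (φ j)))

  private
    -1ⁿ⁻ᵝ≡-1ᵝ : pow ℚ-ring -1ℚ (n ℕ.∸ β) ≡ pow ℚ-ring -1ℚ β
    -1ⁿ⁻ᵝ≡-1ᵝ = sign-inverse (pow-1-sign β) (begin
      pow ℚ-ring -1ℚ β ℚ.* pow ℚ-ring -1ℚ (n ℕ.∸ β)  ≡⟨ pow-+ -1ℚ β (n ℕ.∸ β) ⟨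
      pow ℚ-ring -1ℚ (β ℕ.+ (n ℕ.∸ β))              ≡⟨ ≡.cong (pow ℚ-ring -1ℚ) (ℕP.m+[n∸m]≡n β≤n) ⟩
      pow ℚ-ring -1ℚ n                              ≡⟨ -1ⁿ≡1 ⟩
      1ℚ                                            ∎)
      where open ≡.≡-Reasoning

    -- symbolF, symbolC and symbolA at -1, in terms of sₕ = (-1)^h and s_β = (-1)^β
    symbols-nonzero : ∀ {sₕ s_β} → IsSign sₕ → IsSign s_β →
                      (2# ℚ.* s_β ℚ.+ 2# ℚ.* s_β ≢ 0ℚ) ×
                      (ℚ.- sₕ ℚ.- (2# ℚ.* s_β ℚ.+ 2# ℚ.* s_β) ≢ 0ℚ) ×
                      (2# ℚ.* sₕ ℚ.- (ℚ.- sₕ ℚ.- (2# ℚ.* s_β ℚ.+ 2# ℚ.* s_β)) ≢ 0ℚ)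
    symbols-nonzero (inj₁ ≡.refl) (inj₁ ≡.refl) = (λ ()) , (λ ()) , (λ ())
    symbols-nonzero (inj₁ ≡.refl) (inj₂ ≡.refl) = (λ ()) , (λ ()) , (λ ())
    symbols-nonzero (inj₂ ≡.refl) (inj₁ ≡.refl) = (λ ()) , (λ ()) , (λ ())
    symbols-nonzero (inj₂ ≡.refl) (inj₂ ≡.refl) = (λ ()) , (λ ()) , (λ ())

    sₕ s_β : ℚ
    sₕ = pow ℚ-ring -1ℚ h
    s_β = pow ℚ-ring -1ℚ β

    symbolF-1 : symbolF -1ℚ ≡ 2# ℚ.* s_β ℚ.+ 2# ℚ.* s_β
    symbolF-1 = ≡.cong (λ t → 2# ℚ.* s_β ℚ.+ 2# ℚ.* t) -1ⁿ⁻ᵝ≡-1ᵝ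

    multiple-of-φ : ∀ {x} c j → x ≡ c ℚ.* φ j → c ≢ 0ℚ → x ≢ 0ℚ
    multiple-of-φ c j x≡cφ c≢0 x≡0 = x≢0∧y≢0⇒x*y≢0 c≢0 (φ-nonzero j) (≡.trans (≡.sym x≡cφ) x≡0)

    xb-φ : ∀ j → xb φ j ≡ ℚ.- 2# ℚ.* φ j
    xb-φ j = RingArithmetic.-‿distribˡ-* ℚ-ring 2# (φ j)

  extend-φ-nonzero : ∀ v → extend φ v ≢ 0ℚ
  extend-φ-nonzero (Label.a , j) = multiple-of-φ (symbolA -1ℚ) j (xa-eigen j)
    (λ eq → proj₂ (proj₂ (symbols-nonzero (pow-1-sign h) (pow-1-sign β)))
              (≡.trans (≡.cong (λ t → 2# ℚ.* sₕ ℚ.- (ℚ.- sₕ ℚ.- t)) (≡.sym symbolF-1)) eq))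
  extend-φ-nonzero (Label.b , j) = multiple-of-φ (ℚ.- 2#) j (xb-φ j) (λ ())
  extend-φ-nonzero (Label.c , j) = multiple-of-φ (symbolC -1ℚ) j (xc-eigen j)
    (λ eq → proj₁ (proj₂ (symbols-nonzero (pow-1-sign h) (pow-1-sign β)))
              (≡.trans (≡.cong (λ t → ℚ.- sₕ ℚ.- t) (≡.sym symbolF-1)) eq))
  extend-φ-nonzero (Label.d , j) = φ-nonzero j
  extend-φ-nonzero (Label.e , j) = φ-nonzero j
  extend-φ-nonzero (Label.f , j) = multiple-of-φ (symbolF -1ℚ) j (xf-eigen j)
    (λ eq → proj₁ (symbols-nonzero (pow-1-sign h) (pow-1-sign β)) (≡.trans (≡.sym symbolF-1) eq))
  extend-φ-nonzero (Label.g , j) = multiple-of-φ (ℚ.- 2#) j (xb-φ j) (λ ())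

  symbol-1≢0 : symbol 1ℚ ≢ 0ℚ
  symbol-1≢0 symbol≡0 = L𝟙≢0 (begin
    L 𝟙 Fin.zero          ≡⟨ L-eigen Fin.zero ⟩
    symbol 1ℚ ℚ.* 1ℚ      ≡⟨ ≡.cong (ℚ._* 1ℚ) symbol≡0 ⟩
    0ℚ                    ∎)
    where
    open ≡.≡-Reasoning
    𝟙 : Fin n → ℚ
    𝟙 _ = 1ℚ
    open Eigenvector 1ℚ 𝟙 (λ _ k → ≡.sym (≡.trans (≡.cong (ℚ._* 1ℚ) (1-pow k)) (ℚP.*-identityʳ 1ℚ)))
    -- L 𝟙 evaluates to the constant 12
    L𝟙≢0 : L 𝟙 Fin.zero ≢ 0ℚ
    L𝟙≢0 ()

  module ℚFourier = DiscreteFourier ℚ-ring m -1ℚ -1ⁿ≡1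

  module OverField {c ℓ : Level} (K : CommutativeRing c ℓ) (isField : IsField K) (charZero : CharZero K) where
    open CommutativeRing K hiding (zero)
    open CharZeroField K isField charZero public
    module LK = ReducedOperator K m h α β
    private
      module RK = RingArithmetic K
    open import Relation.Binary.Reasoning.Setoid setoid

    fromℚ-L : ∀ D j → fromℚ (L D j) ≈ LK.L (λ i → fromℚ (D i)) j
    fromℚ-L D j = +-hom (xa D (j ⊕ α) ℚ.+ xa D (j ⊖ α)) (xb D j)
                        (+-hom (xa D (j ⊕ α)) (xa D (j ⊖ α)) (xa-hom (j ⊕ α)) (xa-hom (j ⊖ α))) (xb-hom j)
      where
      +-hom : ∀ x y {x′ y′} → fromℚ x ≈ x′ → fromℚ y ≈ y′ → fromℚ (x ℚ.+ y) ≈ x′ + y′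
      +-hom x y x≈ y≈ = trans (fromℚ-homo-+ x y) (+-cong x≈ y≈)
      neg-hom : ∀ x {x′} → fromℚ x ≈ x′ → fromℚ (ℚ.- x) ≈ - x′
      neg-hom x x≈ = trans (fromℚ-homo-neg x) (-‿cong x≈)
      2*-hom : ∀ i → fromℚ (2# ℚ.* D i) ≈ LK.2# * fromℚ (D i)
      2*-hom i = trans (fromℚ-homo-* 2# (D i)) (*-congʳ (fromℚ-natK 2))
      xf-hom : ∀ i → fromℚ (xf D i) ≈ LK.xf (λ i → fromℚ (D i)) i
      xf-hom i = +-hom (2# ℚ.* D (i ⊕ β)) (2# ℚ.* D (i ⊖ β)) (2*-hom (i ⊕ β)) (2*-hom (i ⊖ β))
      xc-hom : ∀ i → fromℚ (xc D i) ≈ LK.xc (λ i → fromℚ (D i)) i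
      xc-hom i = +-hom (ℚ.- D (i ⊕ h)) (ℚ.- xf D i) (neg-hom (D (i ⊕ h)) refl) (neg-hom (xf D i) (xf-hom i))
      xa-hom : ∀ i → fromℚ (xa D i) ≈ LK.xa (λ i → fromℚ (D i)) i
      xa-hom i = +-hom (2# ℚ.* D (i ⊕ h)) (ℚ.- xc D i) (2*-hom (i ⊕ h)) (neg-hom (xc D i) (xc-hom i))
      xb-hom : ∀ i → fromℚ (xb D i) ≈ LK.xb (λ i → fromℚ (D i)) i
      xb-hom i = neg-hom (2# ℚ.* D i) (2*-hom i)

    fromℚ-polyG7-−1 : fromℚ (polyG7 ℚ-ring h α β -1ℚ) ≈ polyG7 K h α β (- 1#)
    fromℚ-polyG7-−1 = trans (fromℚ-polyG7 h α β -1ℚ) (RK.polyG7-cong h α β (trans (fromℚ-homo-neg 1ℚ) (-‿cong fromℚ-1)))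

    symbol-−1≡0⇒polyG7≈0 : symbol -1ℚ ≡ 0ℚ → polyG7 K h α β (- 1#) ≈ 0#
    symbol-−1≡0⇒polyG7≈0 symbol≡0 = begin
      polyG7 K h α β (- 1#)            ≈⟨ fromℚ-polyG7-−1 ⟨
      fromℚ (polyG7 ℚ-ring h α β -1ℚ)  ≡⟨ ≡.cong fromℚ (symbol≈0⇒polyG7≈0 -1ⁿ≡1 α≤n β≤n symbol≡0) ⟩
      fromℚ 0ℚ                         ≈⟨ fromℚ-0 ⟩
      0#                               ∎

    polyG7≈0⇒symbol-−1≡0 : polyG7 K h α β (- 1#) ≈ 0# → symbol -1ℚ ≡ 0ℚ
    polyG7≈0⇒symbol-−1≡0 poly≈0 = polyG7≈0⇒symbol≈0 -1ⁿ≡1 α≤n β≤n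
      (fromℚ-injective _ _ (trans fromℚ-polyG7-−1 (trans poly≈0 (sym fromℚ-0))))

  module FromNut (x₀ : Vertex n → ℚ) (x₀∈ker : InKernel Adj x₀) (x₀≢0 : ∀ v → x₀ v ≢ 0ℚ)
                 (x₀-spans : ∀ y → InKernel Adj y → ∃ λ t → ∀ v → y v ≡ t ℚ.* x₀ v) where
    open Restriction x₀ x₀∈ker renaming (D to D₀; L-restriction to L-D₀)

    D₀≢0 : ∀ j → D₀ j ≢ 0ℚ
    D₀≢0 j = x₀≢0 (Label.d , j)

    ker-L-spanned : ∀ D → (∀ j → L D j ≡ 0ℚ) → ∃ λ t → ∀ j → D j ≡ t ℚ.* D₀ j
    ker-L-spanned D LD≡0 = proj₁ spans , λ j → proj₂ spans (Label.d , j)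
      where
      spans : ∃ λ t → ∀ v → extend D v ≡ t ℚ.* x₀ v
      spans = x₀-spans (extend D) (extend-kernel D LD≡0)

    private
      shifted : ∃ λ μ → ∀ j → D₀ (j ⊕ 1) ≡ μ ℚ.* D₀ j
      shifted = ker-L-spanned (λ j → D₀ (j ⊕ 1)) (λ j → ≡.trans (L-shift D₀ 1 j) (L-D₀ (j ⊕ 1)))

      μ : ℚ
      μ = proj₁ shifted

      D₀-eigen : ∀ j k → D₀ (j ⊕ k) ≡ pow ℚ-ring μ k ℚ.* D₀ j
      D₀-eigen j zero    = ≡.trans (≡.cong D₀ (⊕-0 j)) (≡.sym (ℚP.*-identityˡ (D₀ j)))
      D₀-eigen j (suc k) = begin
        D₀ (j ⊕ suc k)                          ≡⟨ ≡.cong D₀ (≡.trans (≡.cong (j ⊕_) (ℕP.+-comm 1 k)) (≡.sym (⊕-+ j k 1))) ⟩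
        D₀ (j ⊕ k ⊕ 1)                          ≡⟨ proj₂ shifted (j ⊕ k) ⟩
        μ ℚ.* D₀ (j ⊕ k)                        ≡⟨ ≡.cong (μ ℚ.*_) (D₀-eigen j k) ⟩
        μ ℚ.* (pow ℚ-ring μ k ℚ.* D₀ j)          ≡⟨ ℚP.*-assoc μ _ (D₀ j) ⟨
        pow ℚ-ring μ (suc k) ℚ.* D₀ j            ∎
        where open ≡.≡-Reasoning

      μⁿ≡1 : pow ℚ-ring μ n ≡ 1ℚ
      μⁿ≡1 = FieldLemmas.*-cancelˡ ℚ-ring ℚ-isField (D₀≢0 Fin.zero) (begin
        D₀ Fin.zero ℚ.* pow ℚ-ring μ n   ≡⟨ ℚP.*-comm (D₀ Fin.zero) _ ⟩
        pow ℚ-ring μ n ℚ.* D₀ Fin.zero   ≡⟨ D₀-eigen Fin.zero n ⟨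
        D₀ (Fin.zero ⊕ n)                ≡⟨ ≡.cong D₀ (⊕-n Fin.zero) ⟩
        D₀ Fin.zero                      ≡⟨ ℚP.*-identityʳ _ ⟨
        D₀ Fin.zero ℚ.* 1ℚ               ∎)
        where open ≡.≡-Reasoning

      symbol-μ≡0 : symbol μ ≡ 0ℚ
      symbol-μ≡0 = x*y≡0⇒y≡0 (D₀≢0 Fin.zero) (begin
        D₀ Fin.zero ℚ.* symbol μ         ≡⟨ ℚP.*-comm (D₀ Fin.zero) _ ⟩
        symbol μ ℚ.* D₀ Fin.zero         ≡⟨ L-eigen Fin.zero ⟨
        L D₀ Fin.zero                    ≡⟨ L-D₀ Fin.zero ⟩
        0ℚ                               ∎)
        where
        open Eigenvector μ D₀ D₀-eigen
        open ≡.≡-Reasoning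

    -- μ is a rational n-th root of unity, so μ = ±1, and symbol 1 ≠ 0
    symbol-1≡0 : symbol -1ℚ ≡ 0ℚ
    symbol-1≡0 with root-of-unity m μⁿ≡1
    ... | inj₁ μ≡1  = ⊥-elim (symbol-1≢0 (≡.subst (λ x → symbol x ≡ 0ℚ) μ≡1 symbol-μ≡0))
    ... | inj₂ μ≡-1 = ≡.subst (λ x → symbol x ≡ 0ℚ) μ≡-1 symbol-μ≡0

    private
      e : Fin n → Fin n → ℚ
      e t j = boolℚ (j == t)

      v : Fin n → ℚ
      v j = ℚFourier.δ₀ j ℚ.+ ℚFourier.δ₀ (j ⊕ 1)

    -- A linear relation among these n + 1 vectors of ℚⁿ puts v into the image of L.
    vectors : Fin (suc n) → Fin n → ℚ
    vectors Fin.zero                = φ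
    vectors (Fin.suc Fin.zero)      = v
    vectors (Fin.suc (Fin.suc k))   = L (e (Fin.inject₁ k))

    module LinearRelation (coeff : Fin (suc n) → ℚ) (relation : ∀ r → sum (λ i → coeff i ℚ.* vectors i r) ≡ 0ℚ) where
      private
        c₀ c₁ : ℚ
        c₀ = coeff Fin.zero
        c₁ = coeff (Fin.suc Fin.zero)
        cₖ : Fin m → ℚ
        cₖ k = coeff (Fin.suc (Fin.suc k))

        fourier-φ : ℚFourier.fourier φ ≡ natK ℚ-ring n
        fourier-φ = begin
          sum (λ j → φ j ℚ.* pow ℚ-ring ℚFourier.w (toℕ j))   ≡⟨ sum-cong-≋ term ⟩
          sum {n} (λ _ → 1ℚ)                                  ≡⟨ sum-ones n ⟩
          natK ℚ-ring n                                       ∎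
          where
          open ≡.≡-Reasoning
          term : ∀ j → φ j ℚ.* pow ℚ-ring ℚFourier.w (toℕ j) ≡ 1ℚ
          term j = ≡.trans (≡.sym (pow-distrib-* -1ℚ ℚFourier.w (toℕ j)))
                           (≡.trans (≡.cong (λ x → pow ℚ-ring x (toℕ j)) -1ⁿ≡1) (1-pow (toℕ j)))

        fourier-v : ℚFourier.fourier v ≡ 0ℚ
        fourier-v = ≡.trans (ℚFourier.fourier-+shift ℚFourier.δ₀) (ℚP.*-zeroˡ (ℚFourier.fourier ℚFourier.δ₀))

        fourier-Le : ∀ t → ℚFourier.fourier (L (e t)) ≡ 0ℚ
        fourier-Le t = ≡.trans (fourier-L (e t)) (≡.trans (≡.cong (ℚ._* ℚFourier.fourier (e t)) symbol-1≡0) (ℚP.*-zeroˡ (ℚFourier.fourier (e t))))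
          where open FourierSymbol { -1ℚ} -1ⁿ≡1 h≤n α≤n β≤n

      c₀≡0 : c₀ ≡ 0ℚ
      c₀≡0 = x*y≡0⇒y≡0 (ℚ-charZero m) (begin
        natK ℚ-ring n ℚ.* c₀                                   ≡⟨ ℚP.*-comm _ c₀ ⟩
        c₀ ℚ.* natK ℚ-ring n                                   ≡⟨ ℚP.+-identityʳ _ ⟨
        c₀ ℚ.* natK ℚ-ring n ℚ.+ 0ℚ                            ≡⟨ ≡.cong₂ (λ x y → c₀ ℚ.* x ℚ.+ y) fourier-φ rest≡0 ⟨
        sum (λ i → coeff i ℚ.* ℚFourier.fourier (vectors i))   ≡⟨ ℚFourier.fourier-lincomb coeff vectors ⟨
        ℚFourier.fourier (λ r → sum (λ i → coeff i ℚ.* vectors i r)) ≡⟨ ℚFourier.fourier-zero _ relation ⟩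
        0ℚ                                                     ∎)
        where
        open ≡.≡-Reasoning
        rest≡0 : c₁ ℚ.* ℚFourier.fourier v ℚ.+ sum (λ k → cₖ k ℚ.* ℚFourier.fourier (L (e (Fin.inject₁ k)))) ≡ 0ℚ
        rest≡0 = ≡.cong₂ ℚ._+_ (≡.trans (≡.cong (c₁ ℚ.*_) fourier-v) (ℚP.*-zeroʳ c₁))
                               (sum-zero _ (λ k → ≡.trans (≡.cong (cₖ k ℚ.*_) (fourier-Le _)) (ℚP.*-zeroʳ (cₖ k))))

      c₁≢0 : (∃ λ i → coeff i ≢ 0ℚ) → c₁ ≢ 0ℚ
      c₁≢0 (i , coeffᵢ≢0) c₁≡0 = coeffᵢ≢0 (coeff≡0 i)
        where
        open ≡.≡-Reasoning
        zero-term : ∀ {c} → c ≡ 0ℚ → ∀ x → c ℚ.* x ≡ 0ℚ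
        zero-term ≡.refl x = ℚP.*-zeroˡ x

        relation-L : ∀ r → sum (λ k → cₖ k ℚ.* L (e (Fin.inject₁ k)) r) ≡ 0ℚ
        relation-L r = begin
          S                                    ≡⟨ ℚP.+-identityˡ S ⟨
          0ℚ ℚ.+ S                             ≡⟨ ≡.cong (0ℚ ℚ.+_) (ℚP.+-identityˡ S) ⟨
          0ℚ ℚ.+ (0ℚ ℚ.+ S)                    ≡⟨ ≡.cong₂ (λ x y → x ℚ.+ (y ℚ.+ S)) (zero-term c₀≡0 (φ r)) (zero-term c₁≡0 (v r)) ⟨
          c₀ ℚ.* φ r ℚ.+ (c₁ ℚ.* v r ℚ.+ S)    ≡⟨ relation r ⟩
          0ℚ                                   ∎
          where
          S : ℚ
          S = sum (λ k → cₖ k ℚ.* L (e (Fin.inject₁ k)) r)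

        -- Σ cₖ e k lies in ker L but vanishes at the last coordinate, where D₀ does not
        d : Fin n → ℚ
        d j = sum (λ k → cₖ k ℚ.* e (Fin.inject₁ k) j)

        d-multiple : ∃ λ t → ∀ j → d j ≡ t ℚ.* D₀ j
        d-multiple = ker-L-spanned d (λ j → ≡.trans (L-lincomb cₖ (λ k → e (Fin.inject₁ k)) j) (relation-L j))

        d-last : d (Fin.fromℕ m) ≡ 0ℚ
        d-last = sum-zero _ λ k → ≡.trans (≡.cong (λ b → cₖ k ℚ.* boolℚ b) (==-≢ (FinP.fromℕ≢inject₁ {i = k}))) (ℚP.*-zeroʳ (cₖ k))

        t≡0 : proj₁ d-multiple ≡ 0ℚ
        t≡0 = x*y≡0⇒y≡0 (D₀≢0 (Fin.fromℕ m))
                (≡.trans (ℚP.*-comm (D₀ (Fin.fromℕ m)) _) (≡.trans (≡.sym (proj₂ d-multiple (Fin.fromℕ m))) d-last))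

        d-inject₁ : ∀ k → d (Fin.inject₁ k) ≡ cₖ k
        d-inject₁ k = ≡.trans
          (sum-δ _ k λ k′ k′≢k → ≡.trans (≡.cong (λ b → cₖ k′ ℚ.* boolℚ b) (==-≢ (k′≢k ∘ FinP.inject₁-injective ∘ ≡.sym)))
                                         (ℚP.*-zeroʳ (cₖ k′)))
          (≡.trans (≡.cong (λ b → cₖ k ℚ.* boolℚ b) (==-refl (Fin.inject₁ k))) (ℚP.*-identityʳ (cₖ k)))
          where open import Function using (_∘_)

        coeff≡0 : ∀ i → coeff i ≡ 0ℚ
        coeff≡0 Fin.zero                = c₀≡0
        coeff≡0 (Fin.suc Fin.zero)      = c₁≡0
        coeff≡0 (Fin.suc (Fin.suc k))   = begin
          cₖ k                               ≡⟨ d-inject₁ k ⟨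
          d (Fin.inject₁ k)                  ≡⟨ proj₂ d-multiple (Fin.inject₁ k) ⟩
          proj₁ d-multiple ℚ.* D₀ (Fin.inject₁ k) ≡⟨ ≡.cong (ℚ._* D₀ (Fin.inject₁ k)) t≡0 ⟩
          0ℚ ℚ.* D₀ (Fin.inject₁ k)          ≡⟨ ℚP.*-zeroˡ (D₀ (Fin.inject₁ k)) ⟩
          0ℚ                                 ∎

      module _ {c ℓ : Level} (K : CommutativeRing c ℓ) (isField : IsField K) (charZero : CharZero K)
               (nontrivial : ∃ λ i → coeff i ≢ 0ℚ) where
        open CommutativeRing K hiding (zero)
        open OverField K isField charZero
        private
          module RK = RingArithmetic K
        open import Relation.Binary.Reasoning.Setoid setoid

        polyG7-root-unique : ∀ z → pow K z n ≈ 1# → polyG7 K h α β z ≈ 0# → z ≈ - 1#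
        polyG7-root-unique z zⁿ≈1 poly≈0 = RK.+-inverseʳ-unique 1# z (x*y≈0⇒y≈0 C₁≉0 (begin
            C₁ * (1# + z)                                                     ≈⟨ *-congˡ (*-identityʳ _) ⟨
            C₁ * ((1# + z) * 1#)                                              ≈⟨ *-congˡ fourier-v′ ⟨
            C₁ * KF.fourier (V (Fin.suc Fin.zero))                            ≈⟨ +-identityʳ _ ⟨
            C₁ * KF.fourier (V (Fin.suc Fin.zero)) + 0#                       ≈⟨ +-congˡ (RK.sum-zero _ λ k → trans (*-congˡ (fourier-Le′ k)) (zeroʳ _)) ⟨
            C₁ * KF.fourier (V (Fin.suc Fin.zero)) + RK.sum (λ k → C (Fin.suc (Fin.suc k)) * KF.fourier (V (Fin.suc (Fin.suc k))))
                                                                              ≈⟨ +-identityˡ _ ⟨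
            0# + (C₁ * KF.fourier (V (Fin.suc Fin.zero)) + RK.sum (λ k → C (Fin.suc (Fin.suc k)) * KF.fourier (V (Fin.suc (Fin.suc k)))))
                                                                              ≈⟨ +-congʳ (trans (*-congʳ C₀≈0) (zeroˡ _)) ⟨
            RK.sum (λ i → C i * KF.fourier (V i))                             ≈⟨ KF.fourier-lincomb C V ⟨
            KF.fourier (λ r → RK.sum (λ i → C i * V i r))                     ≈⟨ KF.fourier-zero _ relationK ⟩
            0#                                                                ∎))
          where
          module KF = DiscreteFourier K m z zⁿ≈1
          C : Fin (suc n) → Carrier
          C i = fromℚ (coeff i)
          C₁ : Carrier
          C₁ = C (Fin.suc Fin.zero)
          V : Fin (suc n) → Fin n → Carrier
          V i r = fromℚ (vectors i r)

          C₀≈0 : C Fin.zero ≈ 0#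
          C₀≈0 = trans (fromℚ-cong c₀≡0) fromℚ-0

          C₁≉0 : ¬ (C₁ ≈ 0#)
          C₁≉0 C₁≈0 = c₁≢0 nontrivial (fromℚ-injective _ _ (trans C₁≈0 (sym fromℚ-0)))

          relationK : ∀ r → RK.sum (λ i → C i * V i r) ≈ 0#
          relationK r = begin
            RK.sum (λ i → C i * V i r)                          ≈⟨ RK.sum-cong-≋ (λ i → fromℚ-homo-* (coeff i) (vectors i r)) ⟨
            RK.sum (λ i → fromℚ (coeff i ℚ.* vectors i r))      ≈⟨ fromℚ-sum (λ i → coeff i ℚ.* vectors i r) ⟨
            fromℚ (sum (λ i → coeff i ℚ.* vectors i r))         ≈⟨ fromℚ-cong (relation r) ⟩
            fromℚ 0ℚ                                            ≈⟨ fromℚ-0 ⟩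
            0#                                                  ∎

          fromℚ-δ₀ : ∀ j → fromℚ (ℚFourier.δ₀ j) ≈ KF.δ₀ j
          fromℚ-δ₀ Fin.zero    = fromℚ-1
          fromℚ-δ₀ (Fin.suc j) = fromℚ-0

          fourier-v′ : KF.fourier (V (Fin.suc Fin.zero)) ≈ (1# + z) * 1#
          fourier-v′ = begin
            KF.fourier (V (Fin.suc Fin.zero))              ≈⟨ KF.fourier-cong (λ j → trans (fromℚ-homo-+ (ℚFourier.δ₀ j) (ℚFourier.δ₀ (j ⊕ 1))) (+-cong (fromℚ-δ₀ j) (fromℚ-δ₀ (j ⊕ 1)))) ⟩
            KF.fourier (λ j → KF.δ₀ j + KF.δ₀ (j ⊕ 1))      ≈⟨ KF.fourier-+shift KF.δ₀ ⟩
            (1# + z) * KF.fourier KF.δ₀                    ≈⟨ *-congˡ KF.fourier-δ₀ ⟩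
            (1# + z) * 1#                                  ∎

          fourier-Le′ : ∀ k → KF.fourier (V (Fin.suc (Fin.suc k))) ≈ 0#
          fourier-Le′ k = begin
            KF.fourier (V (Fin.suc (Fin.suc k)))                   ≈⟨ KF.fourier-cong (fromℚ-L (e (Fin.inject₁ k))) ⟩
            KF.fourier (LK.L (λ i → fromℚ (e (Fin.inject₁ k) i)))  ≈⟨ fourier-L (λ i → fromℚ (e (Fin.inject₁ k) i)) ⟩
            LK.symbol z * KF.fourier (λ i → fromℚ (e (Fin.inject₁ k) i)) ≈⟨ *-congʳ (LK.polyG7≈0⇒symbol≈0 zⁿ≈1 α≤n β≤n poly≈0) ⟩
            0# * KF.fourier (λ i → fromℚ (e (Fin.inject₁ k) i))    ≈⟨ zeroˡ _ ⟩
            0#                                                     ∎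
            where open LK.FourierSymbol zⁿ≈1 h≤n α≤n β≤n


  module NutToRoots {c ℓ : Level} (K : CommutativeRing c ℓ) (isField : IsField K) (charZero : CharZero K) where
    open CommutativeRing K hiding (zero)
    open OverField K isField charZero

    nut⇒root-conditions : IsNutGraph Adj →
      polyG7 K h α β (- 1#) ≈ 0# × (∀ z → pow K z n ≈ 1# → polyG7 K h α β z ≈ 0# → z ≈ - 1#)
    nut⇒root-conditions (_ , x₀ , x₀∈ker , x₀≢0 , x₀-spans) =
      symbol-−1≡0⇒polyG7≈0 symbol-1≡0 , polyG7-root-unique K isField charZero nontrivial
      where
      open FromNut x₀ x₀∈ker x₀≢0 x₀-spans
      open LinearDependence ℚ-ring ℚ-isField ℚP._≟_
      relation : Dependent vectors
      relation = dependent n vectors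
      open LinearRelation (proj₁ relation) (proj₂ (proj₂ relation))
      nontrivial : ∃ λ i → proj₁ relation i ≢ 0ℚ
      nontrivial = proj₁ (proj₂ relation)


  module RootsToNut {c ℓ : Level} (K : CommutativeRing c ℓ) (isField : IsField K) (charZero : CharZero K)
               (ω : CommutativeRing.Carrier K) (ω-primitive : IsPrimitiveRoot K n ω) where
    open CommutativeRing K hiding (zero)
    open OverField K isField charZero
    open PrimitiveRootOfUnity K isField m ω ω-primitive
    private
      module RK = RingArithmetic K
    open import Relation.Binary.Reasoning.Setoid setoid

    module _ (-1-only-root : ∀ z → pow K z n ≈ 1# → polyG7 K h α β z ≈ 0# → z ≈ - 1#) where
      private
        h<n : h ℕ.< n
        h<n = ≡.subst (h ℕ.<_) h+h≡n (ℕP.m<m+n h 1≤h)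

        k₋₁ : Fin n
        k₋₁ = Fin.fromℕ< h<n

        root-k₋₁ : root k₋₁ ≈ - 1#
        root-k₋₁ = trans (≡⇒≈ (≡.cong (pow K ω) (FinP.toℕ-fromℕ< h<n))) (pow-ω-half 1≤h h+h≡n)
          where open RingArithmetic K using (≡⇒≈)

        symbol-root≉0 : ∀ k → k ≢ k₋₁ → ¬ (LK.symbol (root k) ≈ 0#)
        symbol-root≉0 k k≢k₋₁ symbol≈0 = k≢k₋₁ (FinP.toℕ-injective (≡.trans
          (pow-ω-injective (FinP.toℕ<n k) h<n
            (trans (-1-only-root (root k) (rootⁿ≈1 k) (LK.symbol≈0⇒polyG7≈0 (rootⁿ≈1 k) α≤n β≤n symbol≈0))
                   (sym (pow-ω-half 1≤h h+h≡n))))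
          (≡.sym (FinP.toℕ-fromℕ< h<n))))

      ker-L-alternating : ∀ D → (∀ j → L D j ≡ 0ℚ) → ∀ j → D j ≡ D Fin.zero ℚ.* φ j
      ker-L-alternating D LD≡0 j = fromℚ-injective _ _ (*-cancelˡ (charZero m) (begin
        natK K n * F j                                 ≈⟨ inverted j ⟩
        E * pow K (- 1#) (toℕ j)                       ≈⟨ *-congʳ (trans (sym (*-identityʳ E)) (sym (inverted Fin.zero))) ⟩
        natK K n * F Fin.zero * pow K (- 1#) (toℕ j)   ≈⟨ *-assoc _ _ _ ⟩
        natK K n * (F Fin.zero * pow K (- 1#) (toℕ j)) ≈⟨ *-congˡ (*-congˡ fromℚ-φ) ⟨
        natK K n * (F Fin.zero * fromℚ (φ j))          ≈⟨ *-congˡ (fromℚ-homo-* (D Fin.zero) (φ j)) ⟨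
        natK K n * fromℚ (D Fin.zero ℚ.* φ j)          ∎))
        where
        F : Fin n → Carrier
        F i = fromℚ (D i)

        E : Carrier
        E = Fourierₖ.fourier k₋₁ F

        fromℚ-φ : fromℚ (φ j) ≈ pow K (- 1#) (toℕ j)
        fromℚ-φ = trans (fromℚ-pow -1ℚ (toℕ j)) (RK.pow-cong (toℕ j) (trans (fromℚ-homo-neg 1ℚ) (-‿cong fromℚ-1)))

        -- F lies in the kernel of L over K, so only its Fourier coefficient at -1 survives
        fourier-F : ∀ k → k ≢ k₋₁ → Fourierₖ.fourier k F ≈ 0#
        fourier-F k k≢k₋₁ = x*y≈0⇒y≈0 (symbol-root≉0 k k≢k₋₁) (begin
          LK.symbol (root k) * Fourierₖ.fourier k F   ≈⟨ fourier-L F ⟨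
          Fourierₖ.fourier k (LK.L F)                 ≈⟨ Fourierₖ.fourier-zero k (LK.L F) (λ i → trans (sym (fromℚ-L D i)) (trans (fromℚ-cong (LD≡0 i)) fromℚ-0)) ⟩
          0#                                          ∎)
          where open LK.FourierSymbol (rootⁿ≈1 k) h≤n α≤n β≤n

        inverted : ∀ j → natK K n * F j ≈ E * pow K (- 1#) (toℕ j)
        inverted j = begin
          natK K n * F j                                        ≈⟨ fourier-inversion F j ⟨
          RK.sum (λ k → Fourierₖ.fourier k F * pow K (root k) (toℕ j))
            ≈⟨ RK.sum-δ _ k₋₁ (λ k k≢k₋₁ → trans (*-congʳ {pow K (root k) (toℕ j)} (fourier-F k k≢k₋₁)) (zeroˡ _)) ⟩
          E * pow K (root k₋₁) (toℕ j)                          ≈⟨ *-congˡ (RK.pow-cong (toℕ j) root-k₋₁) ⟩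
          E * pow K (- 1#) (toℕ j)                              ∎

      isNut : symbol -1ℚ ≡ 0ℚ → IsNutGraph Adj
      isNut symbol≡0 = ((Label.a , Fin.zero) , (Label.b , Fin.zero) , λ ())
                     , extend φ , extend-kernel φ (L-φ symbol≡0) , extend-φ-nonzero , spans
        where
        spans : ∀ y → InKernel Adj y → ∃ λ t → ∀ v → y v ≡ t ℚ.* extend φ v
        spans y y∈ker = D Fin.zero , λ v → ≡.trans (x≡extend v) (extend-* (D Fin.zero) (ker-L-alternating D L-restriction) v)
          where open Restriction y y∈ker

lemma9 : (n α β : ℕ) → 4 ≤ n → 2 ∣ n → 1 ≤ α → α < n / 2 → 1 ≤ β → β < n / 2 →
    ∀ {c ℓ} (K : CommutativeRing c ℓ) → IsField K → CharZero K →
    (ω : CommutativeRing.Carrier K) → IsPrimitiveRoot K n ω →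
    IsNutGraph (adjMatrixG7 n α β) ⇔
    ((CommutativeRing._≈_ K (polyG7 K (n / 2) α β (CommutativeRing.-_ K (CommutativeRing.1# K))) (CommutativeRing.0# K)) ×
    (∀ (z : CommutativeRing.Carrier K) → CommutativeRing._≈_ K (pow K z n) (CommutativeRing.1# K) →
    CommutativeRing._≈_ K (polyG7 K (n / 2) α β z) (CommutativeRing.0# K) →
    CommutativeRing._≈_ K z (CommutativeRing.-_ K (CommutativeRing.1# K))))
lemma9 (suc m) α β _ 2∣n 1≤α α<h 1≤β β<h K isField charZero ω ω-primitive =
  mk⇔ nut⇒root-conditions (λ (poly≈0 , -1-only-root) → isNut -1-only-root (polyG7≈0⇒symbol-−1≡0 poly≈0))
  where
  open import Data.Nat.DivMod using (m/n*n≡m)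

  h : ℕ
  h = suc m / 2

  h+h≡n : h ℕ.+ h ≡ suc m
  h+h≡n = ≡.trans (≡.cong (h ℕ.+_) (≡.sym (ℕP.+-identityʳ h))) (≡.trans (ℕP.*-comm 2 h) (m/n*n≡m 2∣n))

  2a<n : ∀ {a} → a < h → a ℕ.+ a < suc m
  2a<n {a} a<h = ≡.subst (a ℕ.+ a <_) h+h≡n (ℕP.+-mono-< a<h a<h)

  open NutCriterion m α β h+h≡n 1≤α (2a<n α<h) 1≤β (2a<n β<h)
  open NutToRoots K isField charZero
  open RootsToNut K isField charZero ω ω-primitive
  open OverField K isField charZero using (polyG7≈0⇒symbol-−1≡0)
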